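{- Let $d\ge 1$. In the ring of formal power series $\mathbb{Z}[t][[q]]$, $$\sum_{\pi \in \mathcal{P}^{(d)}} t^{\mathrm{cor}(\pi)} q^{|\pi|_{ch}} = \prod_{n \ge 1} (1 - t q^{n})^{ -\binom{n + d - 2}{d - 1}},$$ where the sum runs over all $d$-dimensional partitions $\pi$.
   Context: $\mathbb{Z}_+$ denotes the positive integers, $\mathbf{e}_1,\dots,\mathbf{e}_{d+1}$ the standard basis vectors of $\mathbb{Z}^{d+1}$. A $d$-dimensional partition is an array $\pi=(\pi_{i_1,\ldots,i_d})_{i_1,\ldots,i_d\ge 1}$ of nonnegative integers with finitely many nonzero entries such that $\pi_{i_1,\ldots,i_d}\ge \pi_{j_1,\ldots,j_d}$ whenever $i_1\le j_1,\ldots,i_d\le j_d$; $\mathcal{P}^{(d)}$ is the set of them. The diagram of $\pi$ is $D(\pi)=\{(i_1,\ldots,i_d,i)\in\mathbb{Z}_+^{d+1} : 1\le i\le \pi_{i_1,\ldots,i_d}\}$. The set of corners is $\mathrm{Cor}(\pi)=\{\mathbf{i}\in D(\pi): \mathbf{i}+\mathbf{e}_\ell\notin D(\pi)\text{ for all }\ell\in[d]\}$ (only the first $d$ directions), and $\mathrm{cor}(\pi)=|\mathrm{Cor}(\pi)|$. For $(i_1,\ldots,i_d)\in\mathbb{Z}_+^d$ put $\mathrm{ch}(i_1,\ldots,i_d)=i_1+\cdots+i_d-d+1$. The corner-hook volume is $|\pi|_{ch}=\sum_{(\mathbf{i},i_{d+1})\in\mathrm{Cor}(\pi)}\mathrm{ch}(\mathbf{i})$,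 where $\mathbf{i}\in\mathbb{Z}_+^d$. -}

module Defs where

open import Data.Nat using (ℕ; zero; suc; _≤_; _<_; _∸_; _≤?_)
import Data.Nat as N
open import Data.Nat.Combinatorics using (_C_)
open import Data.Integer using (ℤ; +_; -_) renaming (_+_ to _+ℤ_; _*_ to _*ℤ_)
open import Data.Fin using (Fin)
open import Data.Fin.Properties using (all?)
open import Data.Vec using (Vec; []; _∷_; lookup; updateAt; toList)
import Data.Vec as V
open import Data.List using (List; [_]; map; concatMap; upTo; filter; length)
open import Data.Nat.ListAction using (sum)
open import Data.Product using (Σ; Σ-syntax; _×_; _,_; proj₁; proj₂)
open import Relation.Binary.PropositionalEquality using (_≡_; _≢_)
open import Relation.Nullary using (¬_; Dec; yes; no)
open import Relation.Nullary.Decidable using (_×-dec_; ¬?)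

-- Convention: the index (i_1,…,i_d) ∈ ℤ_+^d of the paper is stored
-- 0-based as a vector (i_1 - 1, …, i_d - 1) ∈ ℕ^d.  The last coordinate
-- i_{d+1} of a cell of the diagram is kept 1-based, as in the paper.

Index : ℕ → Set
Index d = Vec ℕ d

_≼_ : ∀ {d} → Index d → Index d → Set
_≼_ {d} i j = (l : Fin d) → lookup i l ≤ lookup j l

record Partition (d : ℕ) : Set where
  field
    entry  : Index d → ℕ
    mono   : (i j : Index d) → i ≼ j → entry j ≤ entry i
    -- finitely many nonzero entries: all of them lie in the box [0,bound)^d
    bound  : ℕ
    finite : (i : Index d) → entry i ≢ 0 → (l : Fin d) → lookup i l < bound
open Partition public

_≈P_ : ∀ {d} → Partition d → Partition d → Set
_≈P_ {d} π σ = (i : Index d) → entry π i ≡ entry σ i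

Cell : ℕ → Set
Cell d = Index d × ℕ

InD : ∀ {d} → Partition d → Cell d → Set
InD π (i , j) = (1 ≤ j) × (j ≤ entry π i)

InD? : ∀ {d} (π : Partition d) (c : Cell d) → Dec (InD π c)
InD? π (i , j) = (1 ≤? j) ×-dec (j ≤? entry π i)

shift : ∀ {d} → Cell d → Fin d → Cell d
shift (i , j) l = (updateAt i l suc , j)

IsCorner : ∀ {d} → Partition d → Cell d → Set
IsCorner {d} π c = InD π c × ((l : Fin d) → ¬ InD π (shift c l))

IsCorner? : ∀ {d} (π : Partition d) (c : Cell d) → Dec (IsCorner π c)
IsCorner? π c = InD? π c ×-dec all? (λ l → ¬? (InD? π (shift c l)))

box : (d N : ℕ) → List (Index d)
box zero    N = [ [] ]
box (suc d) N = concatMap (λ x → map (x ∷_) (box d N)) (upTo N)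

diagram : ∀ {d} → Partition d → List (Cell d)
diagram {d} π =
  concatMap (λ i → map (λ j → (i , suc j)) (upTo (entry π i))) (box d (bound π))

corners : ∀ {d} → Partition d → List (Cell d)
corners π = filter (IsCorner? π) (diagram π)

cor : ∀ {d} → Partition d → ℕ
cor π = length (corners π)

-- ch(i_1,…,i_d) = i_1 + ⋯ + i_d - d + 1, i.e. (sum of 0-based coords) + 1
ch : ∀ {d} → Index d → ℕ
ch i = suc (V.sum i)

chVol : ∀ {d} → Partition d → ℕ
chVol π = sum (map (λ c → ch (proj₁ c)) (corners π))

HasCard : (A : Set) → (A → A → Set) → ℕ → Set
HasCard A _≈_ n =
  Σ[ f ∈ (A → Fin n) ] Σ[ g ∈ (Fin n → A) ]
    ((x y : A) → x ≈ y → f x ≡ f y) ×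
    ((x : A) → g (f x) ≈ x) ×
    ((k : Fin n) → f (g k) ≡ k)

Fiber : (d k m : ℕ) → Set
Fiber d k m = Σ[ π ∈ Partition d ] (cor π ≡ m × chVol π ≡ k)

_≈F_ : ∀ {d k m} → Fiber d k m → Fiber d k m → Set
x ≈F y = proj₁ x ≈P proj₁ y

-- Formal power series in q and t over ℤ: s k m = coefficient of q^k t^m.
-- (ℤ[t][[q]] embeds coefficientwise into this; all products below are
-- finite sums.)

Ser : Set
Ser = ℕ → ℕ → ℤ

sumTo : ℕ → (ℕ → ℤ) → ℤ
sumTo zero    h = h 0
sumTo (suc n) h = sumTo n h +ℤ h (suc n)

δ : ℕ → ℕ → ℤ
δ zero zero = + 1
δ _    _    = + 0

oneS : Ser
oneS = δ

_*S_ : Ser → Ser → Ser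
(f *S g) k m = sumTo k λ a → sumTo m λ b → f a b *ℤ g (k ∸ a) (m ∸ b)

_^S_ : Ser → ℕ → Ser
f ^S zero  = oneS
f ^S suc c = f *S (f ^S c)

oneMinusTQ : ℕ → Ser
oneMinusTQ n k m with k N.≟ n | m N.≟ 1
... | yes _ | yes _ = - (+ 1)
... | _     | _     = δ k m

expo : ℕ → ℕ → ℕ
expo d n = (n N.+ d ∸ 2) C (d ∸ 1)

prodTo : ℕ → ℕ → Ser
prodTo d zero    = oneS
prodTo d (suc K) = prodTo d K *S (oneMinusTQ (suc K) ^S expo d (suc K))

-- The corners of π over an index i are the cells (i , j) with max_l π(i + e_l) < j ≤ π(i), so
-- their number μ(i) = π(i) ∸ max_l π(i + e_l) recovers π through π(i) = μ(i) + max_l π(i + e_l).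
-- Partitions are thus the finitely supported μ, with cor π = Σ μ(i) and |π|_ch = Σ μ(i) ch(i).
-- Exactly binom(n+d-2, d-1) indices have ch(i) = n, so the coefficients on the left count the
-- multiplicity vectors for the list of weights in which each n occurs that many times. For a
-- list c ∷ L these counts N satisfy N(c ∷ L) = N(L) + t q^c N(c ∷ L), i.e.
-- (1 - t q^c) N(c ∷ L) = N(L); multiplying by the factors of the product one at a time
-- therefore strips the weights off one by one and leaves N([]) = 1.

module Submission where

open import Defs
open import Data.Nat as ℕ using (ℕ; zero; suc; _+_; _*_; _∸_; _⊔_; _≤_; _<_; z≤n; s≤s)
import Data.Nat.Properties as ℕₚ
open import Algebra.Properties.CommutativeSemigroup ℕₚ.+-commutativeSemigroup
  using () renaming (interchange to +-interchange)
open import Data.Integer using (ℤ; +_; _-_) renaming (_+_ to _+ℤ_; _*_ to _*ℤ_)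
import Data.Integer.Properties as ℤₚ
open import Data.Integer.Tactic.RingSolver using (solve-∀)
open import Data.List using (List; []; _∷_; _++_; replicate; length; map; concatMap; upTo; filter)
import Data.List.Properties as Listₚ
open import Data.List.Properties using (++-identityʳ)
open import Data.List.Relation.Unary.All as All using (All; []; _∷_)
import Data.List.Relation.Unary.All.Properties as Allₚ
open import Data.Nat.ListAction using (sum)
open import Data.Fin using (Fin)
open import Data.Vec using ([]; _∷_; lookup; updateAt)
import Data.Vec as Vec
import Data.Vec.Properties as Vecₚ
open import Data.Nat.Combinatorics using (_C_; nCn≡1; nCk+nC[k+1]≡[n+1]C[k+1])
open import Data.Fin.Properties using (+↔⊎; ¬Fin0)
open import Data.Product using (Σ-syntax; _×_; _,_; proj₁; proj₂)
open import Data.Sum using (_⊎_; inj₁; inj₂; map₁; map₂)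
open import Data.Sum.Function.Propositional using (_⊎-↔_)
open import Data.Empty using (⊥-elim)
open import Function.Bundles using (_↔_; mk↔ₛ′; Inverse)
open import Function.Properties.Inverse using (↔-trans; ↔-sym)
open import Relation.Nullary using (¬_; Dec; yes; no)
open import Relation.Unary using (Decidable)
open import Relation.Binary.Definitions using (DecidableEquality; tri<; tri≈; tri>)
open import Function using (_∘_)
open import Relation.Binary.PropositionalEquality
open ≡-Reasoning

-- Formal power series

sumTo-cong : ∀ n {g h : ℕ → ℤ} → (∀ a → a ≤ n → g a ≡ h a) → sumTo n g ≡ sumTo n h
sumTo-cong zero    g≡h = g≡h 0 z≤n
sumTo-cong (suc n) g≡h =
  cong₂ _+ℤ_ (sumTo-cong n (λ a a≤n → g≡h a (ℕₚ.m≤n⇒m≤1+n a≤n))) (g≡h (suc n) ℕₚ.≤-refl)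

sumTo-zero : ∀ n {g : ℕ → ℤ} → (∀ a → a ≤ n → g a ≡ + 0) → sumTo n g ≡ + 0
sumTo-zero zero    g≡0 = g≡0 0 z≤n
sumTo-zero (suc n) g≡0 =
  cong₂ _+ℤ_ (sumTo-zero n (λ a a≤n → g≡0 a (ℕₚ.m≤n⇒m≤1+n a≤n))) (g≡0 (suc n) ℕₚ.≤-refl)

sumTo-- : ∀ n (g h : ℕ → ℤ) → sumTo n (λ a → g a - h a) ≡ sumTo n g - sumTo n h
sumTo-- zero    g h = refl
sumTo-- (suc n) g h =
  trans (cong (_+ℤ (g (suc n) - h (suc n))) (sumTo-- n g h))
        (regroup (sumTo n g) (sumTo n h) (g (suc n)) (h (suc n)))
  where
  regroup : ∀ a b c d → (a - b) +ℤ (c - d) ≡ (a +ℤ c) - (b +ℤ d)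
  regroup = solve-∀

sumTo-truncate : ∀ {n j} {g : ℕ → ℤ} → j ≤ n → (∀ a → j < a → a ≤ n → g a ≡ + 0) →
                 sumTo n g ≡ sumTo j g
sumTo-truncate j≤n vanish with ℕₚ.m≤n⇒m<n∨m≡n j≤n
... | inj₂ refl = refl
sumTo-truncate {suc n} {j} {g} _ vanish | inj₁ (s≤s j≤n) = begin
  sumTo n g +ℤ g (suc n) ≡⟨ cong₂ _+ℤ_ (sumTo-truncate j≤n vanishBelow) (vanish (suc n) (s≤s j≤n) ℕₚ.≤-refl) ⟩
  sumTo j g +ℤ + 0       ≡⟨ ℤₚ.+-identityʳ _ ⟩
  sumTo j g              ∎
  where
  vanishBelow : ∀ a → j < a → a ≤ n → g a ≡ + 0
  vanishBelow a j<a a≤n = vanish a j<a (ℕₚ.m≤n⇒m≤1+n a≤n)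

sumTo-single : ∀ {n} p {g : ℕ → ℤ} → p ≤ n → (∀ a → a ≤ n → a ≢ p → g a ≡ + 0) →
               sumTo n g ≡ g p
sumTo-single zero    p≤n vanish =
  sumTo-truncate p≤n (λ a 0<a a≤n → vanish a a≤n (ℕₚ.>⇒≢ 0<a))
sumTo-single {n} (suc p) {g} p≤n vanish = begin
  sumTo n g                ≡⟨ sumTo-truncate p≤n (λ a p<a a≤n → vanish a a≤n (ℕₚ.>⇒≢ p<a)) ⟩
  sumTo p g +ℤ g (suc p)   ≡⟨ cong (_+ℤ g (suc p)) (sumTo-zero p vanishBelow) ⟩
  + 0 +ℤ g (suc p)         ≡⟨ ℤₚ.+-identityˡ _ ⟩
  g (suc p)                ∎
  where
  vanishBelow : ∀ a → a ≤ p → g a ≡ + 0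
  vanishBelow a a≤p = vanish a (ℕₚ.≤-trans (ℕₚ.m≤n⇒m≤1+n a≤p) p≤n) (ℕₚ.<⇒≢ (s≤s a≤p))

sumTo²-single : ∀ {k m} p r {g : ℕ → ℕ → ℤ} → p ≤ k → r ≤ m →
                (∀ a b → a ≤ k → b ≤ m → a ≢ p ⊎ b ≢ r → g a b ≡ + 0) →
                sumTo k (λ a → sumTo m (g a)) ≡ g p r
sumTo²-single {k} {m} p r p≤k r≤m vanish =
  trans (sumTo-single p p≤k (λ a a≤k a≢p → sumTo-zero m (λ b b≤m → vanish a b a≤k b≤m (inj₁ a≢p))))
        (sumTo-single r r≤m (λ b b≤m b≢r → vanish p b p≤k b≤m (inj₂ b≢r)))

infix 4 _≗S_ _≈[_]_
infixl 6 _-S_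

_≗S_ : Ser → Ser → Set
f ≗S g = ∀ k m → f k m ≡ g k m

_≈[_]_ : Ser → ℕ → Ser → Set
f ≈[ K ] g = ∀ k m → k ≤ K → f k m ≡ g k m

_-S_ : Ser → Ser → Ser
(f -S g) k m = f k m - g k m

tq : ℕ → Ser
tq c k m with k ℕ.≟ c | m ℕ.≟ 1
... | yes _ | yes _ = + 1
... | _     | _     = + 0

mulTQ : ℕ → Ser → Ser
mulTQ c g k zero    = + 0
mulTQ c g k (suc m) with c ℕ.≤? k
... | yes _ = g (k ∸ c) m
... | no  _ = + 0

mulOneMinusTQ : ℕ → Ser → Ser
mulOneMinusTQ c g = g -S mulTQ c g

mulOneMinusTQs : List ℕ → Ser → Ser
mulOneMinusTQs []      f = f
mulOneMinusTQs (c ∷ L) f = mulOneMinusTQs L (mulOneMinusTQ c f)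

δ≡0 : ∀ {a b} → a ≢ 0 ⊎ b ≢ 0 → δ a b ≡ + 0
δ≡0 {zero}  {zero}  (inj₁ a≢0) = ⊥-elim (a≢0 refl)
δ≡0 {zero}  {zero}  (inj₂ b≢0) = ⊥-elim (b≢0 refl)
δ≡0 {zero}  {suc b} _          = refl
δ≡0 {suc a} {b}     _          = refl

tq≡0 : ∀ c a b → a ≢ c ⊎ b ≢ 1 → tq c a b ≡ + 0
tq≡0 c a b off with a ℕ.≟ c | b ℕ.≟ 1 | off
... | yes a≡c | yes _   | inj₁ a≢c = ⊥-elim (a≢c a≡c)
... | yes _   | yes b≡1 | inj₂ b≢1 = ⊥-elim (b≢1 b≡1)
... | yes _   | no  _   | _        = refl
... | no  _   | _       | _        = refl

tq-at : ∀ c → tq c c 1 ≡ + 1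
tq-at c with c ℕ.≟ c
... | yes _   = refl
... | no  c≢c = ⊥-elim (c≢c refl)

oneMinusTQ-≗ : ∀ c → oneMinusTQ c ≗S oneS -S tq c
oneMinusTQ-≗ c k m with k ℕ.≟ c | m ℕ.≟ 1
... | yes _ | yes refl = cong (_- + 1) (sym (δ≡0 {k} (inj₂ λ ())))
... | yes _ | no  _    = sym (ℤₚ.+-identityʳ _)
... | no  _ | _        = sym (ℤₚ.+-identityʳ _)

mulTQ-≤ : ∀ c g {k} m → c ≤ k → mulTQ c g k (suc m) ≡ g (k ∸ c) m
mulTQ-≤ c g {k} m c≤k with c ℕ.≤? k
... | yes _   = refl
... | no  c≰k = ⊥-elim (c≰k c≤k)

mulTQ-≰ : ∀ c g {k} m → ¬ c ≤ k → mulTQ c g k m ≡ + 0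
mulTQ-≰ c g zero    c≰k = refl
mulTQ-≰ c g {k} (suc m) c≰k with c ℕ.≤? k
... | yes c≤k = ⊥-elim (c≰k c≤k)
... | no  _   = refl

mulTQ-cong≤ : ∀ c {f g} K → f ≈[ K ] g → mulTQ c f ≈[ K ] mulTQ c g
mulTQ-cong≤ c K f≈g k zero    k≤K = refl
mulTQ-cong≤ c K f≈g k (suc m) k≤K with c ℕ.≤? k
... | yes _ = f≈g (k ∸ c) m (ℕₚ.≤-trans (ℕₚ.m∸n≤m k c) k≤K)
... | no  _ = refl

mulOneMinusTQs-cong≤ : ∀ L {f g} K → f ≈[ K ] g → mulOneMinusTQs L f ≈[ K ] mulOneMinusTQs L g
mulOneMinusTQs-cong≤ []      K f≈g = f≈g
mulOneMinusTQs-cong≤ (c ∷ L) K f≈g = mulOneMinusTQs-cong≤ L K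
  (λ k m k≤K → cong₂ _-_ (f≈g k m k≤K) (mulTQ-cong≤ c K f≈g k m k≤K))

mulOneMinusTQs-cong : ∀ L {f g} → f ≗S g → mulOneMinusTQs L f ≗S mulOneMinusTQs L g
mulOneMinusTQs-cong L f≗g k m = mulOneMinusTQs-cong≤ L k (λ k m _ → f≗g k m) k m ℕₚ.≤-refl

mulOneMinusTQs-++ : ∀ L R f → mulOneMinusTQs (L ++ R) f ≡ mulOneMinusTQs R (mulOneMinusTQs L f)
mulOneMinusTQs-++ []      R f = refl
mulOneMinusTQs-++ (c ∷ L) R f = mulOneMinusTQs-++ L R (mulOneMinusTQ c f)

*S-congˡ : ∀ {f f′} g → f ≗S f′ → f *S g ≗S f′ *S g
*S-congˡ g f≗f′ k m = sumTo-cong k (λ a _ → sumTo-cong m (λ b _ → cong (_*ℤ g (k ∸ a) (m ∸ b)) (f≗f′ a b)))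

*S-congʳ : ∀ f {g g′} → g ≗S g′ → f *S g ≗S f *S g′
*S-congʳ f g≗g′ k m = sumTo-cong k (λ a _ → sumTo-cong m (λ b _ → cong (f a b *ℤ_) (g≗g′ (k ∸ a) (m ∸ b))))

*S-distribʳ--S : ∀ f g h → (f -S g) *S h ≗S (f *S h) -S (g *S h)
*S-distribʳ--S f g h k m = trans
  (sumTo-cong k (λ a _ → trans (sumTo-cong m (λ b _ → distrib (f a b) (g a b) (h (k ∸ a) (m ∸ b))))
                               (sumTo-- m _ _)))
  (sumTo-- k _ _)
  where
  distrib : ∀ x y z → (x - y) *ℤ z ≡ x *ℤ z - y *ℤ z
  distrib = solve-∀

*S-distribˡ--S : ∀ f g h → f *S (g -S h) ≗S (f *S g) -S (f *S h)
*S-distribˡ--S f g h k m = trans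
  (sumTo-cong k (λ a _ → trans (sumTo-cong m (λ b _ → distrib (f a b) (g (k ∸ a) (m ∸ b)) (h (k ∸ a) (m ∸ b))))
                               (sumTo-- m _ _)))
  (sumTo-- k _ _)
  where
  distrib : ∀ x y z → x *ℤ (y - z) ≡ x *ℤ y - x *ℤ z
  distrib = solve-∀

*S-identityˡ : ∀ h → oneS *S h ≗S h
*S-identityˡ h k m = trans
  (sumTo²-single 0 0 z≤n z≤n vanish)
  (ℤₚ.*-identityˡ (h k m))
  where
  vanish : ∀ a b → a ≤ k → b ≤ m → a ≢ 0 ⊎ b ≢ 0 → δ a b *ℤ h (k ∸ a) (m ∸ b) ≡ + 0
  vanish a b _ _ off = trans (cong (_*ℤ h (k ∸ a) (m ∸ b)) (δ≡0 off)) (ℤₚ.*-zeroˡ (h (k ∸ a) (m ∸ b)))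

*S-identityʳ : ∀ f → f *S oneS ≗S f
*S-identityʳ f k m = begin
  (f *S oneS) k m                ≡⟨ sumTo²-single k m ℕₚ.≤-refl ℕₚ.≤-refl vanish ⟩
  f k m *ℤ δ (k ∸ k) (m ∸ m)     ≡⟨ cong₂ (λ u v → f k m *ℤ δ u v) (ℕₚ.n∸n≡0 k) (ℕₚ.n∸n≡0 m) ⟩
  f k m *ℤ + 1                   ≡⟨ ℤₚ.*-identityʳ (f k m) ⟩
  f k m                          ∎
  where
  ∸≢0 : ∀ {a n} → a ≤ n → a ≢ n → n ∸ a ≢ 0
  ∸≢0 a≤n a≢n = ℕₚ.m>n⇒m∸n≢0 (ℕₚ.≤∧≢⇒< a≤n a≢n)
  vanish : ∀ a b → a ≤ k → b ≤ m → a ≢ k ⊎ b ≢ m → f a b *ℤ δ (k ∸ a) (m ∸ b) ≡ + 0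
  vanish a b a≤k b≤m (inj₁ a≢k) = trans (cong (f a b *ℤ_) (δ≡0 (inj₁ (∸≢0 a≤k a≢k)))) (ℤₚ.*-zeroʳ (f a b))
  vanish a b a≤k b≤m (inj₂ b≢m) = trans (cong (f a b *ℤ_) (δ≡0 (inj₂ (∸≢0 b≤m b≢m)))) (ℤₚ.*-zeroʳ (f a b))

tq-*S : ∀ c h → tq c *S h ≗S mulTQ c h
tq-*S c h k zero = sumTo-zero k λ a _ →
  trans (cong (_*ℤ h (k ∸ a) 0) (tq≡0 c a 0 (inj₂ λ ()))) (ℤₚ.*-zeroˡ (h (k ∸ a) 0))
tq-*S c h k (suc m) with c ℕ.≤? k
... | yes c≤k = begin
  (tq c *S h) k (suc m)        ≡⟨ sumTo²-single {k} {suc m} c 1 c≤k (s≤s z≤n) (λ a b _ _ off → vanish a b off) ⟩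
  tq c c 1 *ℤ h (k ∸ c) m      ≡⟨ cong (_*ℤ h (k ∸ c) m) (tq-at c) ⟩
  + 1 *ℤ h (k ∸ c) m           ≡⟨ ℤₚ.*-identityˡ _ ⟩
  h (k ∸ c) m                  ∎
  where
  vanish : ∀ a b → a ≢ c ⊎ b ≢ 1 → tq c a b *ℤ h (k ∸ a) (suc m ∸ b) ≡ + 0
  vanish a b off = trans (cong (_*ℤ h (k ∸ a) (suc m ∸ b)) (tq≡0 c a b off)) (ℤₚ.*-zeroˡ (h (k ∸ a) (suc m ∸ b)))
... | no c≰k = sumTo-zero k (λ a a≤k → sumTo-zero (suc m) (λ b _ → vanish a b a≤k))
  where
  vanish : ∀ a b → a ≤ k → tq c a b *ℤ h (k ∸ a) (suc m ∸ b) ≡ + 0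
  vanish a b a≤k = trans (cong (_*ℤ h (k ∸ a) (suc m ∸ b)) (tq≡0 c a b (inj₁ λ { refl → c≰k a≤k })))
                         (ℤₚ.*-zeroˡ (h (k ∸ a) (suc m ∸ b)))

oneMinusTQ-*S : ∀ c h → oneMinusTQ c *S h ≗S mulOneMinusTQ c h
oneMinusTQ-*S c h k m = begin
  (oneMinusTQ c *S h) k m                        ≡⟨ *S-congˡ h (oneMinusTQ-≗ c) k m ⟩
  ((oneS -S tq c) *S h) k m                      ≡⟨ *S-distribʳ--S oneS (tq c) h k m ⟩
  (oneS *S h) k m - (tq c *S h) k m              ≡⟨ cong₂ _-_ (*S-identityˡ h k m) (tq-*S c h k m) ⟩
  h k m - mulTQ c h k m                          ∎

≤∸-swap : ∀ {a c k} → a ≤ k → c ≤ k ∸ a → a ≤ k ∸ c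
≤∸-swap {a} {c} {k} a≤k c≤k∸a = subst (_≤ k ∸ c) (ℕₚ.m∸[m∸n]≡n a≤k) (ℕₚ.∸-monoʳ-≤ k c≤k∸a)

∸-comm : ∀ k a c → k ∸ a ∸ c ≡ k ∸ c ∸ a
∸-comm k a c = begin
  k ∸ a ∸ c    ≡⟨ ℕₚ.∸-+-assoc k a c ⟩
  k ∸ (a + c)  ≡⟨ cong (k ∸_) (ℕₚ.+-comm a c) ⟩
  k ∸ (c + a)  ≡⟨ ℕₚ.∸-+-assoc k c a ⟨
  k ∸ c ∸ a    ∎

*S-mulTQ : ∀ c f g → f *S mulTQ c g ≗S mulTQ c (f *S g)
*S-mulTQ c f g k zero = sumTo-zero k (λ a _ → ℤₚ.*-zeroʳ (f a 0))
*S-mulTQ c f g k (suc m) with c ℕ.≤? k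
... | yes c≤k = begin
  sumTo k (λ a → sumTo (suc m) (λ b → f a b *ℤ mulTQ c g (k ∸ a) (suc m ∸ b)))
    ≡⟨ sumTo-cong k (λ a _ → dropLastTerm a) ⟩
  sumTo k (λ a → inner a)
    ≡⟨ sumTo-truncate (ℕₚ.m∸n≤m k c) (λ a k∸c<a a≤k → sumTo-zero m (λ b _ → tooLarge a b k∸c<a a≤k)) ⟩
  sumTo (k ∸ c) (λ a → inner a)
    ≡⟨ sumTo-cong (k ∸ c) (λ a a≤k∸c → sumTo-cong m (λ b _ → cong (f a b *ℤ_) (unshift a b a≤k∸c))) ⟩
  (f *S g) (k ∸ c) m
    ∎
  where
  inner : ℕ → ℤ
  inner a = sumTo m (λ b → f a b *ℤ mulTQ c g (k ∸ a) (suc (m ∸ b)))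
  dropLastTerm : ∀ a → sumTo (suc m) (λ b → f a b *ℤ mulTQ c g (k ∸ a) (suc m ∸ b)) ≡ inner a
  dropLastTerm a = begin
    _ ≡⟨ cong₂ _+ℤ_ (sumTo-cong m (λ b b≤m → cong (λ z → f a b *ℤ mulTQ c g (k ∸ a) z) (ℕₚ.+-∸-assoc 1 b≤m)))
                    (trans (cong (λ z → f a (suc m) *ℤ mulTQ c g (k ∸ a) z) (ℕₚ.n∸n≡0 m)) (ℤₚ.*-zeroʳ (f a (suc m)))) ⟩
    inner a +ℤ + 0 ≡⟨ ℤₚ.+-identityʳ _ ⟩
    inner a ∎
  tooLarge : ∀ a b → k ∸ c < a → a ≤ k → f a b *ℤ mulTQ c g (k ∸ a) (suc (m ∸ b)) ≡ + 0
  tooLarge a b k∸c<a a≤k = trans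
    (cong (f a b *ℤ_) (mulTQ-≰ c g (suc (m ∸ b)) (λ c≤k∸a → ℕₚ.<⇒≱ k∸c<a (≤∸-swap a≤k c≤k∸a))))
    (ℤₚ.*-zeroʳ (f a b))
  unshift : ∀ a b → a ≤ k ∸ c → mulTQ c g (k ∸ a) (suc (m ∸ b)) ≡ g (k ∸ c ∸ a) (m ∸ b)
  unshift a b a≤k∸c = begin
    mulTQ c g (k ∸ a) (suc (m ∸ b)) ≡⟨ mulTQ-≤ c g (m ∸ b) (≤∸-swap c≤k a≤k∸c) ⟩
    g (k ∸ a ∸ c) (m ∸ b)           ≡⟨ cong (λ z → g z (m ∸ b)) (∸-comm k a c) ⟩
    g (k ∸ c ∸ a) (m ∸ b)           ∎
... | no c≰k = sumTo-zero k (λ a a≤k → sumTo-zero (suc m) (λ b _ → trans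
  (cong (f a b *ℤ_) (mulTQ-≰ c g (suc m ∸ b) (λ c≤k∸a → c≰k (ℕₚ.≤-trans c≤k∸a (ℕₚ.m∸n≤m k a)))))
  (ℤₚ.*-zeroʳ (f a b))))

*S-mulOneMinusTQ : ∀ c f g → f *S mulOneMinusTQ c g ≗S mulOneMinusTQ c (f *S g)
*S-mulOneMinusTQ c f g k m =
  trans (*S-distribˡ--S f g (mulTQ c g) k m) (cong (λ z → (f *S g) k m - z) (*S-mulTQ c f g k m))

*S-mulOneMinusTQs : ∀ L f g → f *S mulOneMinusTQs L g ≗S mulOneMinusTQs L (f *S g)
*S-mulOneMinusTQs []      f g k m = refl
*S-mulOneMinusTQs (c ∷ L) f g k m = trans
  (*S-mulOneMinusTQs L f (mulOneMinusTQ c g) k m)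
  (mulOneMinusTQs-cong L (*S-mulOneMinusTQ c f g) k m)

oneMinusTQ-^S : ∀ c e → oneMinusTQ c ^S e ≗S mulOneMinusTQs (replicate e c) oneS
oneMinusTQ-^S c zero    k m = refl
oneMinusTQ-^S c (suc e) k m = begin
  (oneMinusTQ c *S (oneMinusTQ c ^S e)) k m          ≡⟨ *S-congʳ (oneMinusTQ c) (oneMinusTQ-^S c e) k m ⟩
  (oneMinusTQ c *S mulOneMinusTQs R oneS) k m        ≡⟨ *S-mulOneMinusTQs R (oneMinusTQ c) oneS k m ⟩
  mulOneMinusTQs R (oneMinusTQ c *S oneS) k m        ≡⟨ mulOneMinusTQs-cong R (oneMinusTQ-*S c oneS) k m ⟩
  mulOneMinusTQs R (mulOneMinusTQ c oneS) k m        ∎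
  where
  R : List ℕ
  R = replicate e c

weights : ℕ → ℕ → List ℕ
weights d zero    = []
weights d (suc K) = weights d K ++ replicate (expo d (suc K)) (suc K)

*S-prodTo : ∀ d K f → f *S prodTo d K ≗S mulOneMinusTQs (weights d K) f
*S-prodTo d zero    f = *S-identityʳ f
*S-prodTo d (suc K) f k m = begin
  (f *S (P *S (oneMinusTQ c ^S e))) k m          ≡⟨ *S-congʳ f (*S-congʳ P (oneMinusTQ-^S c e)) k m ⟩
  (f *S (P *S mulOneMinusTQs R oneS)) k m        ≡⟨ *S-congʳ f (*S-mulOneMinusTQs R P oneS) k m ⟩
  (f *S mulOneMinusTQs R (P *S oneS)) k m        ≡⟨ *S-congʳ f (mulOneMinusTQs-cong R (*S-identityʳ P)) k m ⟩
  (f *S mulOneMinusTQs R P) k m                  ≡⟨ *S-mulOneMinusTQs R f P k m ⟩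
  mulOneMinusTQs R (f *S P) k m                  ≡⟨ mulOneMinusTQs-cong R (*S-prodTo d K f) k m ⟩
  mulOneMinusTQs R (mulOneMinusTQs (weights d K) f) k m
                                                 ≡⟨ cong (λ s → s k m) (mulOneMinusTQs-++ (weights d K) R f) ⟨
  mulOneMinusTQs (weights d (suc K)) f k m       ∎
  where
  c e : ℕ
  c = suc K
  e = expo d (suc K)
  P : Ser
  P = prodTo d K
  R : List ℕ
  R = replicate e c

-- Counting multiplicity vectors of given size and weight

weightedSum : List ℕ → List ℕ → ℕ
weightedSum []      _       = 0
weightedSum (c ∷ L) []      = 0
weightedSum (c ∷ L) (a ∷ x) = a * c + weightedSum L x

record Solutions (L : List ℕ) (k m : ℕ) : Set where
  constructor solution
  field
    mults    : List ℕ
    length≡  : length mults ≡ length L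
    sum≡     : sum mults ≡ m
    weight≡  : weightedSum L mults ≡ k
open Solutions

Solutions-≡ : ∀ {L k m} {s s′ : Solutions L k m} → mults s ≡ mults s′ → s ≡ s′
Solutions-≡ {s = solution x l σ w} {solution .x l′ σ′ w′} refl
  rewrite ℕₚ.≡-irrelevant l l′ | ℕₚ.≡-irrelevant σ σ′ | ℕₚ.≡-irrelevant w w′ = refl

shiftBy : ℕ → (ℕ → ℕ) → ℕ → ℕ
shiftBy zero    g k       = g k
shiftBy (suc c) g zero    = 0
shiftBy (suc c) g (suc k) = shiftBy c g k

shiftBy-≤ : ∀ c g {k} → c ≤ k → shiftBy c g k ≡ g (k ∸ c)
shiftBy-≤ zero    g c≤k       = refl
shiftBy-≤ (suc c) g (s≤s c≤k) = shiftBy-≤ c g c≤k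

shiftBy-≰ : ∀ c g {k} → ¬ c ≤ k → shiftBy c g k ≡ 0
shiftBy-≰ zero    g     c≰k = ⊥-elim (c≰k z≤n)
shiftBy-≰ (suc c) g {zero}  c≰k = refl
shiftBy-≰ (suc c) g {suc k} c≰k = shiftBy-≰ c g (λ c≤k → c≰k (s≤s c≤k))

shiftBy-cong : ∀ c {g h : ℕ → ℕ} {k} → (∀ j → j ≤ k → g j ≡ h j) → shiftBy c g k ≡ shiftBy c h k
shiftBy-cong zero    {k = k}     g≡h = g≡h k ℕₚ.≤-refl
shiftBy-cong (suc c) {k = zero}  g≡h = refl
shiftBy-cong (suc c) {k = suc k} g≡h = shiftBy-cong c (λ j j≤k → g≡h j (ℕₚ.m≤n⇒m≤1+n j≤k))

solutionCount : List ℕ → ℕ → ℕ → ℕ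
solutionCount []      zero    zero    = 1
solutionCount []      zero    (suc m) = 0
solutionCount []      (suc k) m       = 0
solutionCount (c ∷ L) k       zero    = solutionCount L k zero
solutionCount (c ∷ L) k       (suc m) =
  solutionCount L k (suc m) + shiftBy c (λ j → solutionCount (c ∷ L) j m) k

Shifted : ℕ → (ℕ → Set) → ℕ → Set
Shifted c X k = Σ[ j ∈ ℕ ] (c + j ≡ k × X j)

empty↔Fin0 : ∀ {A : Set} → (A → Fin 0) → A ↔ Fin 0
empty↔Fin0 f = mk↔ₛ′ f (λ ()) (λ ()) (λ a → ⊥-elim (¬Fin0 (f a)))

Shifted↔ : ∀ {X : ℕ → Set} {g : ℕ → ℕ} → (∀ j → X j ↔ Fin (g j)) →
           ∀ c k → Shifted c X k ↔ Fin (shiftBy c g k)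
Shifted↔ X↔ zero k = ↔-trans
  (mk↔ₛ′ (λ { (_ , refl , x) → x }) (λ x → k , refl , x) (λ _ → refl) (λ { (_ , refl , _) → refl }))
  (X↔ k)
Shifted↔ X↔ (suc c) zero    = empty↔Fin0 λ { (_ , () , _) }
Shifted↔ X↔ (suc c) (suc k) = ↔-trans
  (mk↔ₛ′ (λ { (j , refl , x) → j , refl , x }) (λ { (j , refl , x) → j , refl , x })
         (λ { (_ , refl , _) → refl }) (λ { (_ , refl , _) → refl }))
  (Shifted↔ X↔ c k)

Solutions-[]↔ : ∀ k m → Solutions [] k m ↔ Fin (solutionCount [] k m)
Solutions-[]↔ zero    zero    = mk↔ₛ′ (λ _ → Fin.zero) (λ _ → solution [] refl refl refl)
  (λ { Fin.zero → refl ; (Fin.suc ()) })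
  (λ { (solution [] _ _ _) → Solutions-≡ refl ; (solution (_ ∷ _) () _ _) })
Solutions-[]↔ zero    (suc m) = empty↔Fin0 λ { (solution [] _ () _) ; (solution (_ ∷ _) () _ _) }
Solutions-[]↔ (suc k) m       = empty↔Fin0 λ { (solution [] _ _ ()) ; (solution (_ ∷ _) () _ _) }

Solutions-∷-zero↔ : ∀ c L k → Solutions (c ∷ L) k zero ↔ Solutions L k zero
Solutions-∷-zero↔ c L k = mk↔ₛ′ to from (λ _ → Solutions-≡ refl) from∘to
  where
  to : Solutions (c ∷ L) k zero → Solutions L k zero
  to (solution (zero ∷ x) l σ w) = solution x (ℕₚ.suc-injective l) σ w
  to (solution (suc a ∷ x) l () w)
  from : Solutions L k zero → Solutions (c ∷ L) k zero
  from (solution x l σ w) = solution (0 ∷ x) (cong suc l) σ w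
  from∘to : ∀ s → from (to s) ≡ s
  from∘to (solution (zero ∷ x) l σ w) = Solutions-≡ refl
  from∘to (solution (suc a ∷ x) l () w)

Solutions-∷-suc↔ : ∀ c L k m →
  Solutions (c ∷ L) k (suc m) ↔ (Solutions L k (suc m) ⊎ Shifted c (λ j → Solutions (c ∷ L) j m) k)
Solutions-∷-suc↔ c L k m = mk↔ₛ′ split join split∘join join∘split
  where
  split : Solutions (c ∷ L) k (suc m) → Solutions L k (suc m) ⊎ Shifted c (λ j → Solutions (c ∷ L) j m) k
  split (solution (zero ∷ x) l σ w) = inj₁ (solution x (ℕₚ.suc-injective l) σ w)
  split (solution (suc a ∷ x) l σ w) =
    inj₂ ( a * c + weightedSum L x , trans (sym (ℕₚ.+-assoc c (a * c) _)) w
         , solution (a ∷ x) l (ℕₚ.suc-injective σ) refl)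
  join : Solutions L k (suc m) ⊎ Shifted c (λ j → Solutions (c ∷ L) j m) k → Solutions (c ∷ L) k (suc m)
  join (inj₁ (solution x l σ w))             = solution (0 ∷ x) (cong suc l) σ w
  join (inj₂ (j , e , solution (a ∷ x) l σ w)) =
    solution (suc a ∷ x) l (cong suc σ) (trans (ℕₚ.+-assoc c (a * c) _) (trans (cong (_+_ c) w) e))
  split∘join : ∀ s → split (join s) ≡ s
  split∘join (inj₁ _) = cong inj₁ (Solutions-≡ refl)
  split∘join (inj₂ (j , e , solution (a ∷ x) l σ refl)) =
    cong inj₂ (cong₂ (λ p q → j , p , solution (a ∷ x) l q refl) (ℕₚ.≡-irrelevant _ _) (ℕₚ.≡-irrelevant _ _))
  join∘split : ∀ s → join (split s) ≡ s
  join∘split (solution (zero ∷ x) _ _ _) = Solutions-≡ refl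
  join∘split (solution (suc a ∷ x) _ _ _) = Solutions-≡ refl

Solutions↔ : ∀ L k m → Solutions L k m ↔ Fin (solutionCount L k m)
Solutions↔ []      k zero    = Solutions-[]↔ k zero
Solutions↔ []      k (suc m) = Solutions-[]↔ k (suc m)
Solutions↔ (c ∷ L) k zero    = ↔-trans (Solutions-∷-zero↔ c L k) (Solutions↔ L k zero)
Solutions↔ (c ∷ L) k (suc m) = ↔-trans (Solutions-∷-suc↔ c L k m)
  (↔-trans (Solutions↔ L k (suc m) ⊎-↔ Shifted↔ (λ j → Solutions↔ (c ∷ L) j m) c k) (↔-sym +↔⊎))

countSeries : List ℕ → Ser
countSeries L k m = + solutionCount L k m

countSeries-[] : countSeries [] ≗S δ
countSeries-[] zero    zero    = refl
countSeries-[] zero    (suc m) = refl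
countSeries-[] (suc k) m       = refl

mulOneMinusTQ-countSeries : ∀ c L → mulOneMinusTQ c (countSeries (c ∷ L)) ≗S countSeries L
mulOneMinusTQ-countSeries c L k zero    = ℤₚ.+-identityʳ _
mulOneMinusTQ-countSeries c L k (suc m) = byCases (c ℕ.≤? k)
  where
  N shifted M : ℕ
  N = solutionCount L k (suc m)
  shifted = shiftBy c (λ j → solutionCount (c ∷ L) j m) k
  M = solutionCount (c ∷ L) (k ∸ c) m
  cancel : ∀ x y → (x +ℤ y) - y ≡ x
  cancel = solve-∀
  byCases : Dec (c ≤ k) → + (N + shifted) - mulTQ c (countSeries (c ∷ L)) k (suc m) ≡ + N
  byCases (yes c≤k) = begin
    + (N + shifted) - mulTQ c (countSeries (c ∷ L)) k (suc m)
      ≡⟨ cong₂ (λ u v → + (N + u) - v) (shiftBy-≤ c _ c≤k) (mulTQ-≤ c _ m c≤k) ⟩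
    + (N + M) - + M        ≡⟨ cong (_- + M) (ℤₚ.pos-+ N M) ⟩
    (+ N +ℤ + M) - + M     ≡⟨ cancel (+ N) (+ M) ⟩
    + N ∎
  byCases (no c≰k) = begin
    + (N + shifted) - mulTQ c (countSeries (c ∷ L)) k (suc m)
      ≡⟨ cong₂ (λ u v → + (N + u) - v) (shiftBy-≰ c _ c≰k) (mulTQ-≰ c _ (suc m) c≰k) ⟩
    + (N + 0) - + 0  ≡⟨ cong (λ n → + n - + 0) (ℕₚ.+-identityʳ N) ⟩
    + N - + 0        ≡⟨ ℤₚ.+-identityʳ (+ N) ⟩
    + N              ∎

mulOneMinusTQs-countSeries : ∀ L R → mulOneMinusTQs L (countSeries (L ++ R)) ≗S countSeries R
mulOneMinusTQs-countSeries []      R k m = refl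
mulOneMinusTQs-countSeries (c ∷ L) R k m = trans
  (mulOneMinusTQs-cong L (mulOneMinusTQ-countSeries c (L ++ R)) k m)
  (mulOneMinusTQs-countSeries L R k m)

solutionCount-tooHeavy : ∀ {R k} m → All (k <_) R → solutionCount R k m ≡ solutionCount [] k m
solutionCount-tooHeavy m       []            = refl
solutionCount-tooHeavy zero    (k<c ∷ k<R) = solutionCount-tooHeavy zero k<R
solutionCount-tooHeavy {c ∷ R} {k} (suc m) (k<c ∷ k<R) = begin
  solutionCount R k (suc m) + shiftBy c _ k
    ≡⟨ cong₂ _+_ (solutionCount-tooHeavy (suc m) k<R) (shiftBy-≰ c _ (ℕₚ.<⇒≱ k<c)) ⟩
  solutionCount [] k (suc m) + 0             ≡⟨ ℕₚ.+-identityʳ _ ⟩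
  solutionCount [] k (suc m)                 ∎

solutionCount-++-tooHeavy : ∀ L {R k} m → All (k <_) R → solutionCount (L ++ R) k m ≡ solutionCount L k m
solutionCount-++-tooHeavy []      m       k<R = solutionCount-tooHeavy m k<R
solutionCount-++-tooHeavy (c ∷ L) zero    k<R = solutionCount-++-tooHeavy L zero k<R
solutionCount-++-tooHeavy (c ∷ L) (suc m) k<R = cong₂ _+_
  (solutionCount-++-tooHeavy L (suc m) k<R)
  (shiftBy-cong c (λ j j≤k → solutionCount-++-tooHeavy (c ∷ L) m (All.map (ℕₚ.≤-<-trans j≤k) k<R)))

weights-stable : ∀ d {k K} m → k ≤ K → solutionCount (weights d K) k m ≡ solutionCount (weights d k) k m
weights-stable d m k≤K with ℕₚ.m≤n⇒m<n∨m≡n k≤K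
... | inj₂ refl = refl
weights-stable d {K = suc K} m _ | inj₁ (s≤s k≤K) = trans
  (solutionCount-++-tooHeavy (weights d K) m (Allₚ.replicate⁺ (expo d (suc K)) (s≤s k≤K)))
  (weights-stable d m k≤K)

weightCount : ℕ → ℕ → ℕ → ℕ
weightCount d k m = solutionCount (weights d k) k m

weightCount-*S-prodTo : ∀ d K → (λ k m → + weightCount d k m) *S prodTo d K ≈[ K ] δ
weightCount-*S-prodTo d K k m k≤K = begin
  (G *S prodTo d K) k m                          ≡⟨ *S-prodTo d K G k m ⟩
  mulOneMinusTQs W G k m                         ≡⟨ mulOneMinusTQs-cong≤ W K agree k m k≤K ⟩
  mulOneMinusTQs W (countSeries W) k m           ≡⟨ cong (λ L → mulOneMinusTQs W (countSeries L) k m) (++-identityʳ W) ⟨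
  mulOneMinusTQs W (countSeries (W ++ [])) k m   ≡⟨ mulOneMinusTQs-countSeries W [] k m ⟩
  countSeries [] k m                             ≡⟨ countSeries-[] k m ⟩
  δ k m                                          ∎
  where
  W : List ℕ
  W = weights d K
  G : Ser
  G k m = + weightCount d k m
  agree : G ≈[ K ] countSeries W
  agree k m k≤K = cong +_ (sym (weights-stable d m k≤K))

-- Sums over lists and occurrence counts

sumOver : ∀ {A : Set} → List A → (A → ℕ) → ℕ
sumOver []      f = 0
sumOver (x ∷ L) f = f x + sumOver L f

sumOver-cong : ∀ {A : Set} (L : List A) {f g : A → ℕ} → (∀ x → f x ≡ g x) → sumOver L f ≡ sumOver L g
sumOver-cong []      f≡g = refl
sumOver-cong (x ∷ L) f≡g = cong₂ _+_ (f≡g x) (sumOver-cong L f≡g)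

sumOver-++ : ∀ {A : Set} (L R : List A) f → sumOver (L ++ R) f ≡ sumOver L f + sumOver R f
sumOver-++ []      R f = refl
sumOver-++ (x ∷ L) R f = trans (cong (_+_ (f x)) (sumOver-++ L R f)) (sym (ℕₚ.+-assoc (f x) _ _))

sumOver-+ : ∀ {A : Set} (L : List A) f g → sumOver L (λ x → f x + g x) ≡ sumOver L f + sumOver L g
sumOver-+ []      f g = refl
sumOver-+ (x ∷ L) f g = trans (cong (_+_ (f x + g x)) (sumOver-+ L f g))
                              (+-interchange (f x) (g x) (sumOver L f) (sumOver L g))

sumOver-*ʳ : ∀ {A : Set} (L : List A) f c → sumOver L (λ x → f x * c) ≡ sumOver L f * c
sumOver-*ʳ []      f c = refl
sumOver-*ʳ (x ∷ L) f c = trans (cong (_+_ (f x * c)) (sumOver-*ʳ L f c)) (sym (ℕₚ.*-distribʳ-+ c (f x) _))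

sumOver-*ˡ : ∀ {A : Set} (L : List A) f c → sumOver L (λ x → c * f x) ≡ c * sumOver L f
sumOver-*ˡ []      f c = sym (ℕₚ.*-zeroʳ c)
sumOver-*ˡ (x ∷ L) f c = trans (cong (_+_ (c * f x)) (sumOver-*ˡ L f c)) (sym (ℕₚ.*-distribˡ-+ c (f x) _))

sumOver-swap : ∀ {A B : Set} (L : List A) (R : List B) (g : A → B → ℕ) →
               sumOver L (λ x → sumOver R (g x)) ≡ sumOver R (λ y → sumOver L (λ x → g x y))
sumOver-swap []      R g = sym (sumOver-zero R)
  where
  sumOver-zero : ∀ {B : Set} (R : List B) → sumOver R (λ _ → 0) ≡ 0
  sumOver-zero []      = refl
  sumOver-zero (_ ∷ R) = sumOver-zero R
sumOver-swap (x ∷ L) R g =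
  trans (cong (_+_ (sumOver R (g x))) (sumOver-swap L R g)) (sym (sumOver-+ R (g x) _))

sumOver-map : ∀ {A B : Set} (L : List A) (g : A → B) f → sumOver (map g L) f ≡ sumOver L (f ∘ g)
sumOver-map []      g f = refl
sumOver-map (x ∷ L) g f = cong (_+_ (f (g x))) (sumOver-map L g f)

sumOver-concatMap : ∀ {A B : Set} (L : List A) (G : A → List B) f →
                    sumOver (concatMap G L) f ≡ sumOver L (λ x → sumOver (G x) f)
sumOver-concatMap []      G f = refl
sumOver-concatMap (x ∷ L) G f =
  trans (sumOver-++ (G x) (concatMap G L) f) (cong (_+_ (sumOver (G x) f)) (sumOver-concatMap L G f))

sum-map : ∀ {A : Set} (L : List A) f → sum (map f L) ≡ sumOver L f
sum-map []      f = refl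
sum-map (x ∷ L) f = cong (_+_ (f x)) (sum-map L f)

sumOver-upTo-suc : ∀ n f → sumOver (upTo (suc n)) f ≡ sumOver (upTo n) f + f n
sumOver-upTo-suc n f = begin
  sumOver (upTo (suc n)) f          ≡⟨ cong (λ L → sumOver L f) (Listₚ.upTo-∷ʳ n) ⟨
  sumOver (upTo n ++ n ∷ []) f      ≡⟨ sumOver-++ (upTo n) (n ∷ []) f ⟩
  sumOver (upTo n) f + (f n + 0)    ≡⟨ cong (_+_ (sumOver (upTo n) f)) (ℕₚ.+-identityʳ (f n)) ⟩
  sumOver (upTo n) f + f n          ∎

indicator : ∀ {P : Set} → Dec P → ℕ
indicator (yes _) = 1
indicator (no  _) = 0

indicator-yes : ∀ {P : Set} (p? : Dec P) → P → indicator p? ≡ 1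
indicator-yes (yes _) _ = refl
indicator-yes (no ¬p) p = ⊥-elim (¬p p)

indicator-no : ∀ {P : Set} (p? : Dec P) → ¬ P → indicator p? ≡ 0
indicator-no (yes p) ¬p = ⊥-elim (¬p p)
indicator-no (no _)  _  = refl

indicator-⇔ : ∀ {P Q : Set} → (P → Q) → (Q → P) → (p? : Dec P) (q? : Dec Q) → indicator p? ≡ indicator q?
indicator-⇔ to from (yes p) q? = sym (indicator-yes q? (to p))
indicator-⇔ to from (no ¬p) q? = sym (indicator-no q? (¬p ∘ from))

module Occurrences {A : Set} (_≟_ : DecidableEquality A) where

  occ : List A → A → ℕ
  occ L y = sumOver L (λ x → indicator (x ≟ y))

  occ-++ : ∀ L R y → occ (L ++ R) y ≡ occ L y + occ R y
  occ-++ L R y = sumOver-++ L R _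

  sumOver-reindex : ∀ L L′ (f : A → ℕ) → (∀ x → f x ≡ 0 ⊎ (occ L x ≡ 1 × occ L′ x ≡ 1)) →
                    sumOver L f ≡ sumOver L′ f
  sumOver-reindex L L′ f support = begin
    sumOver L f
      ≡⟨ sumOver-cong L (λ x → weighted (occ L′ x) (map₂ proj₂ (support x))) ⟩
    sumOver L (λ x → occ L′ x * f x)
      ≡⟨ sumOver-cong L (λ x → sym (sumOver-*ʳ L′ _ (f x))) ⟩
    sumOver L (λ x → sumOver L′ (λ y → indicator (y ≟ x) * f x))
      ≡⟨ sumOver-swap L L′ _ ⟩
    sumOver L′ (λ y → sumOver L (λ x → indicator (y ≟ x) * f x))
      ≡⟨ sumOver-cong L′ (λ y → sumOver-cong L (λ x → diagonal x y)) ⟩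
    sumOver L′ (λ y → sumOver L (λ x → indicator (x ≟ y) * f y))
      ≡⟨ sumOver-cong L′ (λ y → sumOver-*ʳ L _ (f y)) ⟩
    sumOver L′ (λ y → occ L y * f y)
      ≡⟨ sumOver-cong L′ (λ y → weighted (occ L y) (map₂ proj₁ (support y))) ⟨
    sumOver L′ f
      ∎
    where
    weighted : ∀ {x} n → f x ≡ 0 ⊎ n ≡ 1 → f x ≡ n * f x
    weighted n (inj₁ fx≡0) = trans fx≡0 (sym (trans (cong (n *_) fx≡0) (ℕₚ.*-zeroʳ n)))
    weighted n (inj₂ refl) = sym (ℕₚ.*-identityˡ _)
    diagonal : ∀ x y → indicator (y ≟ x) * f x ≡ indicator (x ≟ y) * f y
    diagonal x y with x ≟ y
    ... | yes refl = cong (_* f x) (indicator-yes (x ≟ x) refl)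
    ... | no  x≢y  = cong (_* f x) (indicator-no (y ≟ x) (x≢y ∘ sym))

  term≤sumOver : ∀ L f {i} → 1 ≤ occ L i → f i ≤ sumOver L f
  term≤sumOver (x ∷ L) f {i} i∈L with x ≟ i
  ... | yes refl = ℕₚ.m≤m+n (f x) _
  ... | no  _    = ℕₚ.≤-trans (term≤sumOver L f i∈L) (ℕₚ.m≤n+m _ (f x))

  -- x read as values on the positions of E; 0 off E
  valueAt : List A → List ℕ → A → ℕ
  valueAt []      _       i = 0
  valueAt (e ∷ E) []      i = 0
  valueAt (e ∷ E) (a ∷ x) i with e ≟ i
  ... | yes _ = a
  ... | no  _ = valueAt E x i

  valueAt-∉ : ∀ E x {i} → occ E i ≡ 0 → valueAt E x i ≡ 0
  valueAt-∉ []      x       _   = refl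
  valueAt-∉ (e ∷ E) []      _   = refl
  valueAt-∉ (e ∷ E) (a ∷ x) {i} i∉E with e ≟ i
  ... | yes _ = ⊥-elim (ℕₚ.1+n≢0 i∉E)
  ... | no  _ = valueAt-∉ E x i∉E

  valueAt-map : ∀ E h {i} → 1 ≤ occ E i → valueAt E (map h E) i ≡ h i
  valueAt-map (e ∷ E) h {i} i∈E with e ≟ i
  ... | yes refl = refl
  ... | no  _    = valueAt-map E h i∈E

  map-valueAt : ∀ E x → (∀ y → occ E y ≤ 1) → length x ≡ length E → map (valueAt E x) E ≡ x
  map-valueAt []      []      _      _ = refl
  map-valueAt (e ∷ E) (a ∷ x) unique l =
    cong₂ _∷_ head (trans (skip E e∉E) (map-valueAt E x unique′ (ℕₚ.suc-injective l)))
    where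
    head : valueAt (e ∷ E) (a ∷ x) e ≡ a
    head with e ≟ e
    ... | yes _   = refl
    ... | no  e≢e = ⊥-elim (e≢e refl)
    e∉E : occ E e ≡ 0
    e∉E = ℕₚ.n≤0⇒n≡0 (ℕₚ.+-cancelˡ-≤ 1 _ _ (subst (λ n → n + occ E e ≤ 1) (indicator-yes (e ≟ e) refl) (unique e)))
    unique′ : ∀ y → occ E y ≤ 1
    unique′ y = ℕₚ.≤-trans (ℕₚ.m≤n+m (occ E y) _) (unique y)
    skip : ∀ L → occ L e ≡ 0 → map (valueAt (e ∷ E) (a ∷ x)) L ≡ map (valueAt E x) L
    skip []      _   = refl
    skip (z ∷ L) e∉zL = cong₂ _∷_ (skipHead (ℕₚ.m+n≡0⇒m≡0 _ e∉zL)) (skip L (ℕₚ.m+n≡0⇒n≡0 _ e∉zL))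
      where
      skipHead : indicator (z ≟ e) ≡ 0 → valueAt (e ∷ E) (a ∷ x) z ≡ valueAt E x z
      skipHead z≠e with e ≟ z
      ... | yes refl = ⊥-elim (ℕₚ.1+n≢0 (trans (sym (indicator-yes (e ≟ e) refl)) z≠e))
      ... | no  _    = refl

indicator-<-suc : ∀ n k → indicator (n ℕ.<? k) + indicator (n ℕ.≟ k) ≡ indicator (n ℕ.<? suc k)
indicator-<-suc n k with ℕₚ.<-cmp n k
... | tri< n<k n≢k _ = trans (cong₂ _+_ (indicator-yes (n ℕ.<? k) n<k) (indicator-no (n ℕ.≟ k) n≢k))
                             (sym (indicator-yes (n ℕ.<? suc k) (ℕₚ.m<n⇒m<1+n n<k)))
... | tri≈ n≮k n≡k _ = trans (cong₂ _+_ (indicator-no (n ℕ.<? k) n≮k) (indicator-yes (n ℕ.≟ k) n≡k))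
                             (sym (indicator-yes (n ℕ.<? suc k) (ℕₚ.≤-reflexive (cong suc n≡k))))
... | tri> n≮k n≢k k<n = trans (cong₂ _+_ (indicator-no (n ℕ.<? k) n≮k) (indicator-no (n ℕ.≟ k) n≢k))
                               (sym (indicator-no (n ℕ.<? suc k) (ℕₚ.<⇒≱ k<n ∘ ℕₚ.m<1+n⇒m≤n)))

occ-upTo : ∀ B y → sumOver (upTo B) (λ x → indicator (x ℕ.≟ y)) ≡ indicator (y ℕ.<? B)
occ-upTo zero    y = sym (indicator-no (y ℕ.<? 0) λ ())
occ-upTo (suc B) y = begin
  sumOver (upTo (suc B)) (λ x → indicator (x ℕ.≟ y))          ≡⟨ sumOver-upTo-suc B _ ⟩
  sumOver (upTo B) (λ x → indicator (x ℕ.≟ y)) + indicator (B ℕ.≟ y)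
    ≡⟨ cong₂ _+_ (occ-upTo B y) (indicator-⇔ sym sym (B ℕ.≟ y) (y ℕ.≟ B)) ⟩
  indicator (y ℕ.<? B) + indicator (y ℕ.≟ B)                  ≡⟨ indicator-<-suc y B ⟩
  indicator (y ℕ.<? suc B)                                    ∎

_≟ᵢ_ : ∀ {d} → DecidableEquality (Index d)
_≟ᵢ_ = Vecₚ.≡-dec ℕ._≟_

open module IndexOccurrences {d} = Occurrences (_≟ᵢ_ {d})

occ-map-∷ : ∀ {d} a (L : List (Index d)) b w → occ (map (a ∷_) L) (b ∷ w) ≡ indicator (a ℕ.≟ b) * occ L w
occ-map-∷ a L b w = begin
  occ (map (a ∷_) L) (b ∷ w)                                ≡⟨ sumOver-map L (a ∷_) _ ⟩
  sumOver L (λ v → indicator ((a ∷ v) ≟ᵢ (b ∷ w)))          ≡⟨ sumOver-cong L split ⟩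
  sumOver L (λ v → indicator (a ℕ.≟ b) * indicator (v ≟ᵢ w)) ≡⟨ sumOver-*ˡ L _ (indicator (a ℕ.≟ b)) ⟩
  indicator (a ℕ.≟ b) * occ L w                             ∎
  where
  split : ∀ v → indicator ((a ∷ v) ≟ᵢ (b ∷ w)) ≡ indicator (a ℕ.≟ b) * indicator (v ≟ᵢ w)
  split v = byCases (a ℕ.≟ b)
    where
    byCases : Dec (a ≡ b) → indicator ((a ∷ v) ≟ᵢ (b ∷ w)) ≡ indicator (a ℕ.≟ b) * indicator (v ≟ᵢ w)
    byCases (yes a≡b) = begin
      indicator ((a ∷ v) ≟ᵢ (b ∷ w))       ≡⟨ indicator-⇔ (cong Vec.tail) (cong₂ _∷_ a≡b) _ (v ≟ᵢ w) ⟩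
      indicator (v ≟ᵢ w)                   ≡⟨ ℕₚ.*-identityˡ _ ⟨
      1 * indicator (v ≟ᵢ w)               ≡⟨ cong (_* indicator (v ≟ᵢ w)) (indicator-yes (a ℕ.≟ b) a≡b) ⟨
      indicator (a ℕ.≟ b) * indicator (v ≟ᵢ w) ∎
    byCases (no a≢b) = trans (indicator-no ((a ∷ v) ≟ᵢ (b ∷ w)) (a≢b ∘ cong Vec.head))
                             (sym (cong (_* indicator (v ≟ᵢ w)) (indicator-no (a ℕ.≟ b) a≢b)))

occ-box : ∀ d B (y : Index d) → (∀ l → lookup y l < B) → occ (box d B) y ≡ 1
occ-box zero    B []       _      = refl
occ-box (suc d) B (y ∷ ys) y<B = begin
  occ (box (suc d) B) (y ∷ ys)
    ≡⟨ sumOver-concatMap (upTo B) (λ x → map (x ∷_) (box d B)) _ ⟩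
  sumOver (upTo B) (λ x → occ (map (x ∷_) (box d B)) (y ∷ ys))
    ≡⟨ sumOver-cong (upTo B) (λ x → occ-map-∷ x (box d B) y ys) ⟩
  sumOver (upTo B) (λ x → indicator (x ℕ.≟ y) * occ (box d B) ys)
    ≡⟨ sumOver-cong (upTo B) (λ x → cong (indicator (x ℕ.≟ y) *_) (occ-box d B ys (y<B ∘ Fin.suc))) ⟩
  sumOver (upTo B) (λ x → indicator (x ℕ.≟ y) * 1)
    ≡⟨ sumOver-cong (upTo B) (λ x → ℕₚ.*-identityʳ _) ⟩
  sumOver (upTo B) (λ x → indicator (x ℕ.≟ y))
    ≡⟨ occ-upTo B y ⟩
  indicator (y ℕ.<? B)
    ≡⟨ indicator-yes (y ℕ.<? B) (y<B Fin.zero) ⟩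
  1 ∎

-- Indices by height

incHead : ∀ {d} → Index (suc d) → Index (suc d)
incHead (a ∷ v) = suc a ∷ v

indicesOfSum : (d s : ℕ) → List (Index d)
indicesOfSum zero    zero    = [] ∷ []
indicesOfSum zero    (suc s) = []
indicesOfSum (suc d) zero    = map (0 ∷_) (indicesOfSum d zero)
indicesOfSum (suc d) (suc s) = map (0 ∷_) (indicesOfSum d (suc s)) ++ map incHead (indicesOfSum (suc d) s)

indicesBelow : (d k : ℕ) → List (Index d)
indicesBelow d zero    = []
indicesBelow d (suc k) = indicesBelow d k ++ indicesOfSum d k

occ-map-incHead-zero : ∀ {d} (L : List (Index (suc d))) w → occ (map incHead L) (0 ∷ w) ≡ 0
occ-map-incHead-zero []            w = refl
occ-map-incHead-zero ((a ∷ v) ∷ L) w =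
  cong₂ _+_ (indicator-no ((suc a ∷ v) ≟ᵢ (0 ∷ w)) λ ()) (occ-map-incHead-zero L w)

occ-map-incHead-suc : ∀ {d} (L : List (Index (suc d))) z w → occ (map incHead L) (suc z ∷ w) ≡ occ L (z ∷ w)
occ-map-incHead-suc []            z w = refl
occ-map-incHead-suc ((a ∷ v) ∷ L) z w =
  cong₂ _+_ (indicator-⇔ unInc (cong incHead) ((suc a ∷ v) ≟ᵢ (suc z ∷ w)) ((a ∷ v) ≟ᵢ (z ∷ w)))
            (occ-map-incHead-suc L z w)
  where
  unInc : suc a ∷ v ≡ suc z ∷ w → a ∷ v ≡ z ∷ w
  unInc eq = cong₂ _∷_ (ℕₚ.suc-injective (proj₁ (Vecₚ.∷-injective eq))) (proj₂ (Vecₚ.∷-injective eq))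

occ-indicesOfSum : ∀ d s y → occ (indicesOfSum d s) y ≡ indicator (Vec.sum y ℕ.≟ s)
occ-indicesOfSum zero    zero    []             = refl
occ-indicesOfSum zero    (suc s) []             = refl
occ-indicesOfSum (suc d) zero    (zero  ∷ ys)   =
  trans (occ-map-∷ 0 (indicesOfSum d zero) 0 ys) (trans (ℕₚ.+-identityʳ _) (occ-indicesOfSum d zero ys))
occ-indicesOfSum (suc d) zero    (suc y ∷ ys)   = occ-map-∷ 0 (indicesOfSum d zero) (suc y) ys
occ-indicesOfSum (suc d) (suc s) (zero  ∷ ys)   = begin
  occ (indicesOfSum (suc d) (suc s)) (0 ∷ ys)
    ≡⟨ occ-++ (map (0 ∷_) (indicesOfSum d (suc s))) _ (0 ∷ ys) ⟩
  occ (map (0 ∷_) (indicesOfSum d (suc s))) (0 ∷ ys) + occ (map incHead (indicesOfSum (suc d) s)) (0 ∷ ys)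
    ≡⟨ cong₂ _+_ (occ-map-∷ 0 (indicesOfSum d (suc s)) 0 ys) (occ-map-incHead-zero (indicesOfSum (suc d) s) ys) ⟩
  (occ (indicesOfSum d (suc s)) ys + 0) + 0
    ≡⟨ trans (ℕₚ.+-identityʳ _) (ℕₚ.+-identityʳ _) ⟩
  occ (indicesOfSum d (suc s)) ys
    ≡⟨ occ-indicesOfSum d (suc s) ys ⟩
  indicator (Vec.sum ys ℕ.≟ suc s) ∎
occ-indicesOfSum (suc d) (suc s) (suc y ∷ ys)   = begin
  occ (indicesOfSum (suc d) (suc s)) (suc y ∷ ys)
    ≡⟨ occ-++ (map (0 ∷_) (indicesOfSum d (suc s))) _ (suc y ∷ ys) ⟩
  occ (map (0 ∷_) (indicesOfSum d (suc s))) (suc y ∷ ys) + occ (map incHead (indicesOfSum (suc d) s)) (suc y ∷ ys)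
    ≡⟨ cong₂ _+_ (occ-map-∷ 0 (indicesOfSum d (suc s)) (suc y) ys) (occ-map-incHead-suc (indicesOfSum (suc d) s) y ys) ⟩
  0 + occ (indicesOfSum (suc d) s) (y ∷ ys)
    ≡⟨ occ-indicesOfSum (suc d) s (y ∷ ys) ⟩
  indicator (y + Vec.sum ys ℕ.≟ s)
    ≡⟨ indicator-⇔ (cong suc) ℕₚ.suc-injective _ _ ⟩
  indicator (suc y + Vec.sum ys ℕ.≟ suc s) ∎

occ-indicesBelow : ∀ d k y → occ (indicesBelow d k) y ≡ indicator (Vec.sum y ℕ.<? k)
occ-indicesBelow d zero    y = sym (indicator-no (Vec.sum y ℕ.<? 0) λ ())
occ-indicesBelow d (suc k) y = begin
  occ (indicesBelow d k ++ indicesOfSum d k) y                      ≡⟨ occ-++ (indicesBelow d k) _ y ⟩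
  occ (indicesBelow d k) y + occ (indicesOfSum d k) y
                                                                    ≡⟨ cong₂ _+_ (occ-indicesBelow d k y) (occ-indicesOfSum d k y) ⟩
  indicator (Vec.sum y ℕ.<? k) + indicator (Vec.sum y ℕ.≟ k)        ≡⟨ indicator-<-suc (Vec.sum y) k ⟩
  indicator (Vec.sum y ℕ.<? suc k)                                  ∎

length-indicesOfSum : ∀ d s → length (indicesOfSum (suc d) s) ≡ (s + d) C d
length-indicesOfSum zero    zero    = refl
length-indicesOfSum zero    (suc s) = trans (Listₚ.length-map incHead (indicesOfSum 1 s)) (length-indicesOfSum zero s)
length-indicesOfSum (suc d) zero    =
  trans (Listₚ.length-map (0 ∷_) (indicesOfSum (suc d) zero))
        (trans (length-indicesOfSum d zero) (trans (nCn≡1 d) (sym (nCn≡1 (suc d)))))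
length-indicesOfSum (suc d) (suc s) = begin
  length (map (0 ∷_) (indicesOfSum (suc d) (suc s)) ++ map incHead (indicesOfSum (suc (suc d)) s))
    ≡⟨ Listₚ.length-++ (map (0 ∷_) (indicesOfSum (suc d) (suc s))) ⟩
  length (map (0 ∷_) (indicesOfSum (suc d) (suc s))) + length (map incHead (indicesOfSum (suc (suc d)) s))
    ≡⟨ cong₂ _+_ (Listₚ.length-map (0 ∷_) (indicesOfSum (suc d) (suc s)))
                 (Listₚ.length-map incHead (indicesOfSum (suc (suc d)) s)) ⟩
  length (indicesOfSum (suc d) (suc s)) + length (indicesOfSum (suc (suc d)) s)
    ≡⟨ cong₂ _+_ (length-indicesOfSum d (suc s)) (length-indicesOfSum (suc d) s) ⟩
  (suc s + d) C d + (s + suc d) C suc d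
    ≡⟨ cong (λ n → n C d + (s + suc d) C suc d) (ℕₚ.+-suc s d) ⟨
  (s + suc d) C d + (s + suc d) C suc d
    ≡⟨ nCk+nC[k+1]≡[n+1]C[k+1] (s + suc d) d ⟩
  suc (s + suc d) C suc d ∎

sum-indicesOfSum : ∀ d s → All (λ v → Vec.sum v ≡ s) (indicesOfSum d s)
sum-indicesOfSum zero    zero    = refl ∷ []
sum-indicesOfSum zero    (suc s) = []
sum-indicesOfSum (suc d) zero    = Allₚ.map⁺ (sum-indicesOfSum d zero)
sum-indicesOfSum (suc d) (suc s) = Allₚ.++⁺ (Allₚ.map⁺ (sum-indicesOfSum d (suc s)))
                                           (Allₚ.map⁺ (All.map (λ {v} → sum-incHead v) (sum-indicesOfSum (suc d) s)))
  where
  sum-incHead : ∀ (v : Index (suc d)) → Vec.sum v ≡ s → Vec.sum (incHead v) ≡ suc s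
  sum-incHead (a ∷ w) = cong suc

map-constant : ∀ {A : Set} (f : A → ℕ) {c} {L : List A} → All (λ x → f x ≡ c) L → map f L ≡ replicate (length L) c
map-constant f []         = refl
map-constant f (fx≡c ∷ p) = cong₂ _∷_ fx≡c (map-constant f p)

map-ch-indicesBelow : ∀ d k → map ch (indicesBelow (suc d) k) ≡ weights (suc d) k
map-ch-indicesBelow d zero    = refl
map-ch-indicesBelow d (suc k) = begin
  map ch (indicesBelow (suc d) k ++ indicesOfSum (suc d) k)
    ≡⟨ Listₚ.map-++ ch (indicesBelow (suc d) k) _ ⟩
  map ch (indicesBelow (suc d) k) ++ map ch (indicesOfSum (suc d) k)
    ≡⟨ cong₂ _++_ (map-ch-indicesBelow d k) (map-constant ch (All.map (cong suc) (sum-indicesOfSum (suc d) k))) ⟩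
  weights (suc d) k ++ replicate (length (indicesOfSum (suc d) k)) (suc k)
    ≡⟨ cong (λ n → weights (suc d) k ++ replicate n (suc k)) (trans (length-indicesOfSum d k) expo≡) ⟩
  weights (suc d) (suc k) ∎
  where
  expo≡ : (k + d) C d ≡ expo (suc d) (suc k)
  expo≡ = cong (λ n → (n ∸ 1) C d) (sym (ℕₚ.+-suc k d))

infixl 25 _+e_
-- Corner counts of a partition

_+e_ : ∀ {d} → Index d → Fin d → Index d
i +e l = updateAt i l suc

maxOver : ∀ {d} → (Fin d → ℕ) → ℕ
maxOver {zero}  f = 0
maxOver {suc d} f = f Fin.zero ⊔ maxOver (f ∘ Fin.suc)

maxOver-lub : ∀ {d} (f : Fin d → ℕ) {n} → (∀ l → f l ≤ n) → maxOver f ≤ n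
maxOver-lub {zero}  f f≤n = z≤n
maxOver-lub {suc d} f f≤n = ℕₚ.⊔-lub (f≤n Fin.zero) (maxOver-lub (f ∘ Fin.suc) (f≤n ∘ Fin.suc))

maxOver-ub : ∀ {d} (f : Fin d → ℕ) l → f l ≤ maxOver f
maxOver-ub f Fin.zero    = ℕₚ.m≤m⊔n _ _
maxOver-ub f (Fin.suc l) = ℕₚ.≤-trans (maxOver-ub (f ∘ Fin.suc) l) (ℕₚ.m≤n⊔m _ _)

maxOver-cong : ∀ {d} {f g : Fin d → ℕ} → (∀ l → f l ≡ g l) → maxOver f ≡ maxOver g
maxOver-cong {zero}  f≡g = refl
maxOver-cong {suc d} f≡g = cong₂ _⊔_ (f≡g Fin.zero) (maxOver-cong (f≡g ∘ Fin.suc))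

maxOver-zero : ∀ {d} (f : Fin d → ℕ) → (∀ l → f l ≡ 0) → maxOver f ≡ 0
maxOver-zero f f≡0 = ℕₚ.n≤0⇒n≡0 (maxOver-lub f (ℕₚ.≤-reflexive ∘ f≡0))

≼-+e : ∀ {d} (i : Index d) l → i ≼ i +e l
≼-+e (a ∷ i) Fin.zero    Fin.zero     = ℕₚ.n≤1+n a
≼-+e (a ∷ i) Fin.zero    (Fin.suc l′) = ℕₚ.≤-refl
≼-+e (a ∷ i) (Fin.suc l) Fin.zero     = ℕₚ.≤-refl
≼-+e (a ∷ i) (Fin.suc l) (Fin.suc l′) = ≼-+e i l l′

sum-+e : ∀ {d} (i : Index d) l → Vec.sum (i +e l) ≡ suc (Vec.sum i)
sum-+e (a ∷ i) Fin.zero    = refl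
sum-+e (a ∷ i) (Fin.suc l) = trans (cong (_+_ a) (sum-+e i l)) (ℕₚ.+-suc a (Vec.sum i))

sum-+e-+suc : ∀ {d} (i : Index d) l f → Vec.sum i + suc f ≡ Vec.sum (i +e l) + f
sum-+e-+suc i l f = trans (ℕₚ.+-suc (Vec.sum i) f) (cong (_+ f) (sym (sum-+e i l)))

lookup≤sum : ∀ {d} (i : Index d) l → lookup i l ≤ Vec.sum i
lookup≤sum (a ∷ i) Fin.zero    = ℕₚ.m≤m+n a _
lookup≤sum (a ∷ i) (Fin.suc l) = ℕₚ.≤-trans (lookup≤sum i l) (ℕₚ.m≤n+m _ a)

sum≤*-bound : ∀ {d} (i : Index d) {B} → (∀ l → lookup i l ≤ B) → Vec.sum i ≤ d * B
sum≤*-bound []      _   = z≤n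
sum≤*-bound (a ∷ i) i≤B = ℕₚ.+-mono-≤ (i≤B Fin.zero) (sum≤*-bound i (i≤B ∘ Fin.suc))

antitone-≼ : ∀ {d} (Q : Index d → ℕ) → (∀ i l → Q (i +e l) ≤ Q i) → ∀ i j → i ≼ j → Q j ≤ Q i
antitone-≼ {zero}  Q step [] [] _ = ℕₚ.≤-refl
antitone-≼ {suc d} Q step (a ∷ i) (b ∷ j) i≼j =
  ℕₚ.≤-trans (headStep a b (i≼j Fin.zero))
             (antitone-≼ (λ v → Q (a ∷ v)) (λ v l → step (a ∷ v) (Fin.suc l)) i j (i≼j ∘ Fin.suc))
  where
  headStep : ∀ a b → a ≤ b → Q (b ∷ j) ≤ Q (a ∷ j)
  headStep a zero    z≤n = ℕₚ.≤-refl
  headStep a (suc b) a≤1+b with ℕₚ.m≤n⇒m<n∨m≡n a≤1+b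
  ... | inj₂ refl      = ℕₚ.≤-refl
  ... | inj₁ (s≤s a≤b) = ℕₚ.≤-trans (step (b ∷ j) Fin.zero) (headStep a b a≤b)

sumOver-upTo-cong : ∀ n {f g : ℕ → ℕ} → (∀ j → j < n → f j ≡ g j) → sumOver (upTo n) f ≡ sumOver (upTo n) g
sumOver-upTo-cong zero    f≡g = refl
sumOver-upTo-cong (suc n) {f} {g} f≡g = begin
  sumOver (upTo (suc n)) f       ≡⟨ sumOver-upTo-suc n f ⟩
  sumOver (upTo n) f + f n
    ≡⟨ cong₂ _+_ (sumOver-upTo-cong n (λ j j<n → f≡g j (ℕₚ.m<n⇒m<1+n j<n))) (f≡g n (ℕₚ.n<1+n n)) ⟩
  sumOver (upTo n) g + g n       ≡⟨ sumOver-upTo-suc n g ⟨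
  sumOver (upTo (suc n)) g       ∎

count-atLeast : ∀ M n → sumOver (upTo n) (λ j → indicator (M ℕ.≤? j)) ≡ n ∸ M
count-atLeast M zero    = sym (ℕₚ.0∸n≡0 M)
count-atLeast M (suc n) = begin
  sumOver (upTo (suc n)) (λ j → indicator (M ℕ.≤? j))  ≡⟨ sumOver-upTo-suc n _ ⟩
  sumOver (upTo n) (λ j → indicator (M ℕ.≤? j)) + indicator (M ℕ.≤? n)
                                                       ≡⟨ cong (_+ indicator (M ℕ.≤? n)) (count-atLeast M n) ⟩
  n ∸ M + indicator (M ℕ.≤? n)                         ≡⟨ lastStep (M ℕ.≤? n) ⟩
  suc n ∸ M                                            ∎
  where
  lastStep : (M≤?n : Dec (M ≤ n)) → n ∸ M + indicator M≤?n ≡ suc n ∸ M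
  lastStep (yes M≤n) = trans (ℕₚ.+-comm (n ∸ M) 1) (sym (ℕₚ.+-∸-assoc 1 M≤n))
  lastStep (no  M≰n) = trans (ℕₚ.+-identityʳ (n ∸ M))
                             (trans (ℕₚ.m≤n⇒m∸n≡0 (ℕₚ.<⇒≤ n<M)) (sym (ℕₚ.m≤n⇒m∸n≡0 n<M)))
    where
    n<M : n < M
    n<M = ℕₚ.≰⇒> M≰n

sum-map-filter : ∀ {A : Set} {P : A → Set} (P? : Decidable P) (h : A → ℕ) L →
                 sum (map h (filter P? L)) ≡ sumOver L (λ x → indicator (P? x) * h x)
sum-map-filter P? h []      = refl
sum-map-filter P? h (x ∷ L) with P? x
... | yes _ = cong₂ _+_ (sym (ℕₚ.+-identityʳ (h x))) (sum-map-filter P? h L)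
... | no  _ = sum-map-filter P? h L

length≡sum-map-1 : ∀ {A : Set} (L : List A) → length L ≡ sum (map (λ _ → 1) L)
length≡sum-map-1 []      = refl
length≡sum-map-1 (x ∷ L) = cong suc (length≡sum-map-1 L)

above : ∀ {d} → Partition d → Index d → ℕ
above π i = maxOver (λ l → entry π (i +e l))

cornerCount : ∀ {d} → Partition d → Index d → ℕ
cornerCount π i = entry π i ∸ above π i

above≤entry : ∀ {d} (π : Partition d) i → above π i ≤ entry π i
above≤entry π i = maxOver-lub _ (λ l → mono π i (i +e l) (≼-+e i l))

entry≡cornerCount+above : ∀ {d} (π : Partition d) i → entry π i ≡ cornerCount π i + above π i
entry≡cornerCount+above π i = sym (ℕₚ.m∸n+n≡m (above≤entry π i))

cornerCount≢0⇒entry≢0 : ∀ {d} (π : Partition d) i → cornerCount π i ≢ 0 → entry π i ≢ 0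
cornerCount≢0⇒entry≢0 π i c≢0 e≡0 = c≢0 (trans (cong (_∸ above π i) e≡0) (ℕₚ.0∸n≡0 (above π i)))

isCorner⇔ : ∀ {d} (π : Partition d) i {j} → j < entry π i →
            indicator (IsCorner? π (i , suc j)) ≡ indicator (above π i ℕ.≤? j)
isCorner⇔ π i {j} j<πi = indicator-⇔ to from (IsCorner? π (i , suc j)) (above π i ℕ.≤? j)
  where
  to : IsCorner π (i , suc j) → above π i ≤ j
  to (_ , notInD) = maxOver-lub _ (λ l → ℕₚ.≮⇒≥ (λ j<πil → notInD l (s≤s z≤n , j<πil)))
  from : above π i ≤ j → IsCorner π (i , suc j)
  from above≤j = (s≤s z≤n , j<πi) ,
    (λ l (_ , j<πil) → ℕₚ.<⇒≱ j<πil (ℕₚ.≤-trans (maxOver-ub (λ l → entry π (i +e l)) l) above≤j))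

sum-corners : ∀ {d} (π : Partition d) (h : Index d → ℕ) →
              sum (map (h ∘ proj₁) (corners π)) ≡ sumOver (box d (bound π)) (λ i → cornerCount π i * h i)
sum-corners {d} π h = begin
  sum (map (h ∘ proj₁) (corners π))
    ≡⟨ sum-map-filter (IsCorner? π) (h ∘ proj₁) (diagram π) ⟩
  sumOver (diagram π) (λ c → indicator (IsCorner? π c) * h (proj₁ c))
    ≡⟨ sumOver-concatMap (box d (bound π)) column _ ⟩
  sumOver (box d (bound π)) (λ i → sumOver (column i) (λ c → indicator (IsCorner? π c) * h (proj₁ c)))
    ≡⟨ sumOver-cong (box d (bound π)) columnSum ⟩
  sumOver (box d (bound π)) (λ i → cornerCount π i * h i)
    ∎
  where
  column : Index d → List (Cell d)
  column i = map (λ j → i , suc j) (upTo (entry π i))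
  columnSum : ∀ i → sumOver (column i) (λ c → indicator (IsCorner? π c) * h (proj₁ c)) ≡ cornerCount π i * h i
  columnSum i = begin
    sumOver (column i) (λ c → indicator (IsCorner? π c) * h (proj₁ c))
      ≡⟨ sumOver-map (upTo (entry π i)) (λ j → i , suc j) _ ⟩
    sumOver (upTo (entry π i)) (λ j → indicator (IsCorner? π (i , suc j)) * h i)
      ≡⟨ sumOver-*ʳ (upTo (entry π i)) _ (h i) ⟩
    sumOver (upTo (entry π i)) (λ j → indicator (IsCorner? π (i , suc j))) * h i
      ≡⟨ cong (_* h i) (sumOver-upTo-cong (entry π i) (λ j → isCorner⇔ π i)) ⟩
    sumOver (upTo (entry π i)) (λ j → indicator (above π i ℕ.≤? j)) * h i
      ≡⟨ cong (_* h i) (count-atLeast (above π i) (entry π i)) ⟩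
    cornerCount π i * h i
      ∎

cor≡sumOver-cornerCount : ∀ {d} (π : Partition d) → cor π ≡ sumOver (box d (bound π)) (cornerCount π)
cor≡sumOver-cornerCount {d} π = begin
  length (corners π)                                           ≡⟨ length≡sum-map-1 (corners π) ⟩
  sum (map (λ _ → 1) (corners π))                              ≡⟨ sum-corners π (λ _ → 1) ⟩
  sumOver (box d (bound π)) (λ i → cornerCount π i * 1)
                                                               ≡⟨ sumOver-cong (box d (bound π)) (λ i → ℕₚ.*-identityʳ _) ⟩
  sumOver (box d (bound π)) (cornerCount π)                    ∎

chVol≡sumOver-cornerCount : ∀ {d} (π : Partition d) → chVol π ≡ sumOver (box d (bound π)) (λ i → cornerCount π i * ch i)
chVol≡sumOver-cornerCount π = sum-corners π ch

-- Rebuilding a partition from its corner counts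

-- For μ vanishing on indices i with k ≤ Vec.sum i, stack μ k is the partition with corner counts μ.
stack : ∀ {d} → (Index d → ℕ) → ℕ → Index d → ℕ
stack μ zero    i = 0
stack μ (suc f) i = μ i + maxOver (λ l → stack μ f (i +e l))

stack-cong : ∀ {d} {μ ν : Index d → ℕ} → (∀ i → μ i ≡ ν i) → ∀ f i → stack μ f i ≡ stack ν f i
stack-cong μ≡ν zero    i = refl
stack-cong μ≡ν (suc f) i = cong₂ _+_ (μ≡ν i) (maxOver-cong (λ l → stack-cong μ≡ν f (i +e l)))

VanishesFrom : ∀ {d} → ℕ → (Index d → ℕ) → Set
VanishesFrom k μ = ∀ i → k ≤ Vec.sum i → μ i ≡ 0

module _ {d k} {μ : Index d → ℕ} (μ-vanishes : VanishesFrom k μ) where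

  stack-vanishes : ∀ f i → k ≤ Vec.sum i → stack μ f i ≡ 0
  stack-vanishes zero    i _   = refl
  stack-vanishes (suc f) i k≤i = cong₂ _+_ (μ-vanishes i k≤i) (maxOver-zero _ λ l →
    stack-vanishes f (i +e l) (subst (k ≤_) (sym (sum-+e i l)) (ℕₚ.m≤n⇒m≤1+n k≤i)))

  stack-suc : ∀ f i → k ≤ Vec.sum i + f → stack μ (suc f) i ≡ stack μ f i
  stack-suc zero    i k≤i = begin
    μ i + maxOver {d} (λ _ → 0)  ≡⟨ cong (_+_ (μ i)) (maxOver-zero {d} (λ _ → 0) λ _ → refl) ⟩
    μ i + 0                  ≡⟨ ℕₚ.+-identityʳ (μ i) ⟩
    μ i                      ≡⟨ μ-vanishes i (subst (k ≤_) (ℕₚ.+-identityʳ _) k≤i) ⟩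
    0                        ∎
  stack-suc (suc f) i k≤i =
    cong (_+_ (μ i)) (maxOver-cong λ l → stack-suc f (i +e l) (subst (k ≤_) (sum-+e-+suc i l f) k≤i))

  stack-stable : ∀ n {f} i → k ≤ f → stack μ (n + f) i ≡ stack μ f i
  stack-stable zero    i k≤f = refl
  stack-stable (suc n) {f} i k≤f =
    trans (stack-suc (n + f) i (ℕₚ.≤-trans k≤f (ℕₚ.≤-trans (ℕₚ.m≤n+m f n) (ℕₚ.m≤n+m (n + f) (Vec.sum i)))))
          (stack-stable n i k≤f)

  stack-fixed : ∀ i → stack μ k i ≡ μ i + maxOver (λ l → stack μ k (i +e l))
  stack-fixed i = sym (stack-suc k i (ℕₚ.m≤n+m k _))

  fromCornerCounts : Partition d
  fromCornerCounts = record
    { entry  = stack μ k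
    ; mono   = antitone-≼ (stack μ k) step
    ; bound  = k
    ; finite = λ i πi≢0 l → ℕₚ.≰⇒> λ k≤il → πi≢0 (stack-vanishes k i (ℕₚ.≤-trans k≤il (lookup≤sum i l)))
    }
    where
    step : ∀ i l → stack μ k (i +e l) ≤ stack μ k i
    step i l = ℕₚ.≤-trans (maxOver-ub (λ l → stack μ k (i +e l)) l)
                          (ℕₚ.≤-trans (ℕₚ.m≤n+m _ (μ i)) (ℕₚ.≤-reflexive (sym (stack-fixed i))))

  cornerCount-fromCornerCounts : ∀ i → cornerCount fromCornerCounts i ≡ μ i
  cornerCount-fromCornerCounts i =
    trans (cong (_∸ M) (stack-fixed i)) (ℕₚ.m+n∸n≡m (μ i) M)
    where
    M : ℕ
    M = maxOver (λ l → stack μ k (i +e l))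

entry-vanishes-beyond : ∀ {d} (π : Partition d) j → d * bound π < Vec.sum j → entry π j ≡ 0
entry-vanishes-beyond π j dB<j with entry π j ℕ.≟ 0
... | yes πj≡0 = πj≡0
... | no  πj≢0 = ⊥-elim (ℕₚ.<⇒≱ dB<j (sum≤*-bound j (λ l → ℕₚ.<⇒≤ (finite π j πj≢0 l))))

entry≡stack-cornerCount : ∀ {d} (π : Partition d) f i → (∀ j → Vec.sum i + f ≤ Vec.sum j → entry π j ≡ 0) →
                          entry π i ≡ stack (cornerCount π) f i
entry≡stack-cornerCount π zero    i empty = empty i (ℕₚ.≤-reflexive (ℕₚ.+-identityʳ _))
entry≡stack-cornerCount π (suc f) i empty = trans (entry≡cornerCount+above π i)
  (cong (_+_ (cornerCount π i)) (maxOver-cong λ l → entry≡stack-cornerCount π f (i +e l) λ j i+f≤j →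
    empty j (subst (_≤ Vec.sum j) (sym (sum-+e-+suc i l f)) i+f≤j)))

entry≡stack : ∀ {d} (π : Partition d) {k μ} → VanishesFrom k μ → (∀ i → cornerCount π i ≡ μ i) →
              ∀ i → entry π i ≡ stack μ k i
entry≡stack {d} π {k} {μ} μ-vanishes cornerCount≡μ i = begin
  entry π i                    ≡⟨ entry≡stack-cornerCount π n i beyond ⟩
  stack (cornerCount π) n i    ≡⟨ stack-cong cornerCount≡μ n i ⟩
  stack μ n i                  ≡⟨ stack-stable μ-vanishes (suc (d * bound π)) i ℕₚ.≤-refl ⟩
  stack μ k i                  ∎
  where
  n : ℕ
  n = suc (d * bound π) + k
  beyond : ∀ j → Vec.sum i + n ≤ Vec.sum j → entry π j ≡ 0
  beyond j i+n≤j = entry-vanishes-beyond π j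
    (ℕₚ.≤-trans (s≤s (ℕₚ.m≤m+n (d * bound π) k)) (ℕₚ.≤-trans (ℕₚ.m≤n+m n _) i+n≤j))

-- Partitions as multiplicity vectors

cornerCount-cong : ∀ {d} {π σ : Partition d} → π ≈P σ → ∀ i → cornerCount π i ≡ cornerCount σ i
cornerCount-cong π≈σ i = cong₂ _∸_ (π≈σ i) (maxOver-cong λ l → π≈σ (i +e l))

cornerCount≢0⇒inBox : ∀ {d} (π : Partition d) i → cornerCount π i ≢ 0 → occ (box d (bound π)) i ≡ 1
cornerCount≢0⇒inBox {d} π i c≢0 = occ-box d (bound π) i (finite π i (cornerCount≢0⇒entry≢0 π i c≢0))

cornerCount≢0⇒ch≤chVol : ∀ {d} (π : Partition d) i → cornerCount π i ≢ 0 → ch i ≤ chVol π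
cornerCount≢0⇒ch≤chVol {d} π i c≢0 =
  ℕₚ.≤-trans (ch≤multiple (cornerCount π i) c≢0)
    (ℕₚ.≤-trans (term≤sumOver (box d (bound π)) (λ j → cornerCount π j * ch j) (ℕₚ.≤-reflexive (sym i∈box)))
                (ℕₚ.≤-reflexive (sym (chVol≡sumOver-cornerCount π))))
  where
  i∈box : occ (box d (bound π)) i ≡ 1
  i∈box = cornerCount≢0⇒inBox π i c≢0
  ch≤multiple : ∀ n → n ≢ 0 → ch i ≤ n * ch i
  ch≤multiple zero    0≢0 = ⊥-elim (0≢0 refl)
  ch≤multiple (suc n) _   = ℕₚ.m≤m+n (ch i) _

occ-indicesBelow-< : ∀ {d k} {i : Index d} → Vec.sum i < k → occ (indicesBelow d k) i ≡ 1
occ-indicesBelow-< {d} {k} {i} i<k = trans (occ-indicesBelow d k i) (indicator-yes (Vec.sum i ℕ.<? k) i<k)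

occ-indicesBelow-≥ : ∀ {d k} {i : Index d} → k ≤ Vec.sum i → occ (indicesBelow d k) i ≡ 0
occ-indicesBelow-≥ {d} {k} {i} k≤i = trans (occ-indicesBelow d k i) (indicator-no (Vec.sum i ℕ.<? k) (ℕₚ.≤⇒≯ k≤i))

occ-indicesBelow-≤1 : ∀ {d k} (i : Index d) → occ (indicesBelow d k) i ≤ 1
occ-indicesBelow-≤1 {d} {k} i with Vec.sum i ℕ.<? k
... | yes i<k = ℕₚ.≤-reflexive (occ-indicesBelow-< i<k)
... | no  i≮k = ℕₚ.≤-trans (ℕₚ.≤-reflexive (occ-indicesBelow-≥ (ℕₚ.≮⇒≥ i≮k))) z≤n

cornerCount-vanishes : ∀ {d} (π : Partition d) {k} → chVol π ≡ k → VanishesFrom k (cornerCount π)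
cornerCount-vanishes π chVol≡k i k≤i with cornerCount π i ℕ.≟ 0
... | yes c≡0 = c≡0
... | no  c≢0 = ⊥-elim (ℕₚ.<⇒≱ (subst (ch i ≤_) chVol≡k (cornerCount≢0⇒ch≤chVol π i c≢0)) k≤i)

cornerCount-support : ∀ {d} (π : Partition d) {k} → chVol π ≡ k → ∀ i →
  cornerCount π i ≡ 0 ⊎ (occ (indicesBelow d k) i ≡ 1 × occ (box d (bound π)) i ≡ 1)
cornerCount-support π chVol≡k i with cornerCount π i ℕ.≟ 0
... | yes c≡0 = inj₁ c≡0
... | no  c≢0 = inj₂ ( occ-indicesBelow-< (subst (ch i ≤_) chVol≡k (cornerCount≢0⇒ch≤chVol π i c≢0))
                     , cornerCount≢0⇒inBox π i c≢0)

support-*ʳ : ∀ {A : Set} {P : A → Set} {f : A → ℕ} (g : A → ℕ) →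
             (∀ x → f x ≡ 0 ⊎ P x) → ∀ x → f x * g x ≡ 0 ⊎ P x
support-*ʳ g support x = map₁ (λ fx≡0 → cong (_* g x) fx≡0) (support x)

weightedSum-map : ∀ {A : Set} (L : List A) (f g : A → ℕ) → weightedSum (map g L) (map f L) ≡ sumOver L (λ x → f x * g x)
weightedSum-map []      f g = refl
weightedSum-map (x ∷ L) f g = cong (_+_ (f x * g x)) (weightedSum-map L f g)

HasCard-via : ∀ {A B : Set} {_≈_ : A → A → Set} {n} (φ : A → B) (ψ : B → A) →
  (∀ x y → x ≈ y → φ x ≡ φ y) → (∀ x → ψ (φ x) ≈ x) → (∀ y → φ (ψ y) ≡ y) → B ↔ Fin n → HasCard A _≈_ n
HasCard-via {_≈_ = _≈_} φ ψ φ-cong ψ∘φ φ∘ψ B↔Fin =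
  to ∘ φ , ψ ∘ from , (λ x y x≈y → cong to (φ-cong x y x≈y)) , left , right
  where
  open Inverse B↔Fin
  left : ∀ x → ψ (from (to (φ x))) ≈ x
  left x = subst (λ y → ψ y ≈ x) (sym (strictlyInverseʳ (φ x))) (ψ∘φ x)
  right : ∀ k → to (φ (ψ (from k))) ≡ k
  right k = trans (cong to (φ∘ψ (from k))) (strictlyInverseˡ k)

module _ {d k m : ℕ} where

  private
    E : List (Index d)
    E = indicesBelow d k

  toSolution : Fiber d k m → Solutions (map ch E) k m
  toSolution (π , cor≡m , chVol≡k) = solution (map (cornerCount π) E) mults-length mults-sum mults-weight
    where
    support : ∀ i → cornerCount π i ≡ 0 ⊎ (occ E i ≡ 1 × occ (box d (bound π)) i ≡ 1)
    support = cornerCount-support π chVol≡k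
    mults-length : length (map (cornerCount π) E) ≡ length (map ch E)
    mults-length = trans (Listₚ.length-map (cornerCount π) E) (sym (Listₚ.length-map ch E))
    mults-sum : sum (map (cornerCount π) E) ≡ m
    mults-sum = begin
      sum (map (cornerCount π) E)                ≡⟨ sum-map E (cornerCount π) ⟩
      sumOver E (cornerCount π)                  ≡⟨ sumOver-reindex E (box d (bound π)) (cornerCount π) support ⟩
      sumOver (box d (bound π)) (cornerCount π)  ≡⟨ cor≡sumOver-cornerCount π ⟨
      cor π                                      ≡⟨ cor≡m ⟩
      m                                          ∎
    mults-weight : weightedSum (map ch E) (map (cornerCount π) E) ≡ k
    mults-weight = begin
      weightedSum (map ch E) (map (cornerCount π) E)              ≡⟨ weightedSum-map E (cornerCount π) ch ⟩
      sumOver E (λ i → cornerCount π i * ch i)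
        ≡⟨ sumOver-reindex E (box d (bound π)) _ (support-*ʳ ch support) ⟩
      sumOver (box d (bound π)) (λ i → cornerCount π i * ch i)    ≡⟨ chVol≡sumOver-cornerCount π ⟨
      chVol π                                                     ≡⟨ chVol≡k ⟩
      k                                                           ∎

  module FromSolution (s : Solutions (map ch E) k m) where

    μ : Index d → ℕ
    μ = valueAt E (mults s)

    μ-vanishes : VanishesFrom k μ
    μ-vanishes i k≤i = valueAt-∉ E (mults s) (occ-indicesBelow-≥ k≤i)

    partition : Partition d
    partition = fromCornerCounts μ-vanishes

    map-μ : map μ E ≡ mults s
    map-μ = map-valueAt E (mults s) (occ-indicesBelow-≤1 {d} {k}) (trans (length≡ s) (Listₚ.length-map ch E))

    support : ∀ i → μ i ≡ 0 ⊎ (occ E i ≡ 1 × occ (box d k) i ≡ 1)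
    support i with Vec.sum i ℕ.<? k
    ... | yes i<k = inj₂ (occ-indicesBelow-< i<k , occ-box d k i (λ l → ℕₚ.≤-<-trans (lookup≤sum i l) i<k))
    ... | no  i≮k = inj₁ (μ-vanishes i (ℕₚ.≮⇒≥ i≮k))

    cor≡ : cor partition ≡ m
    cor≡ = begin
      cor partition                              ≡⟨ cor≡sumOver-cornerCount partition ⟩
      sumOver (box d k) (cornerCount partition)
        ≡⟨ sumOver-cong (box d k) (cornerCount-fromCornerCounts μ-vanishes) ⟩
      sumOver (box d k) μ                        ≡⟨ sumOver-reindex E (box d k) μ support ⟨
      sumOver E μ                                ≡⟨ sum-map E μ ⟨
      sum (map μ E)                              ≡⟨ cong sum map-μ ⟩
      sum (mults s)                              ≡⟨ sum≡ s ⟩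
      m                                          ∎

    chVol≡ : chVol partition ≡ k
    chVol≡ = begin
      chVol partition                                      ≡⟨ chVol≡sumOver-cornerCount partition ⟩
      sumOver (box d k) (λ i → cornerCount partition i * ch i)
        ≡⟨ sumOver-cong (box d k) (λ i → cong (_* ch i) (cornerCount-fromCornerCounts μ-vanishes i)) ⟩
      sumOver (box d k) (λ i → μ i * ch i)                 ≡⟨ sumOver-reindex E (box d k) _ (support-*ʳ ch support) ⟨
      sumOver E (λ i → μ i * ch i)                         ≡⟨ weightedSum-map E μ ch ⟨
      weightedSum (map ch E) (map μ E)                     ≡⟨ cong (weightedSum (map ch E)) map-μ ⟩
      weightedSum (map ch E) (mults s)                     ≡⟨ weight≡ s ⟩
      k                                                    ∎

  fromSolution : Solutions (map ch E) k m → Fiber d k m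
  fromSolution s = partition , cor≡ , chVol≡
    where open FromSolution s

  toSolution∘fromSolution : ∀ s → toSolution (fromSolution s) ≡ s
  toSolution∘fromSolution s = Solutions-≡
    (trans (Listₚ.map-cong (cornerCount-fromCornerCounts μ-vanishes) E) map-μ)
    where open FromSolution s

  fromSolution∘toSolution : ∀ x → fromSolution (toSolution x) ≈F x
  fromSolution∘toSolution x@(π , _ , chVol≡k) i = sym (entry≡stack π μ-vanishes cornerCount≡μ i)
    where
    open FromSolution (toSolution x)
    cornerCount≡μ : ∀ i → cornerCount π i ≡ μ i
    cornerCount≡μ i with Vec.sum i ℕ.<? k
    ... | yes i<k = sym (valueAt-map E (cornerCount π) (ℕₚ.≤-reflexive (sym (occ-indicesBelow-< i<k))))
    ... | no  i≮k = trans (cornerCount-vanishes π chVol≡k i (ℕₚ.≮⇒≥ i≮k))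
                          (sym (valueAt-∉ E _ (occ-indicesBelow-≥ (ℕₚ.≮⇒≥ i≮k))))

  toSolution-cong : ∀ x y → x ≈F y → toSolution x ≡ toSolution y
  toSolution-cong (π , _) (σ , _) π≈σ = Solutions-≡ (Listₚ.map-cong (cornerCount-cong {π = π} {σ} π≈σ) E)

Fiber-hasCard : ∀ d k m → HasCard (Fiber d k m) _≈F_ (solutionCount (map ch (indicesBelow d k)) k m)
Fiber-hasCard d k m = HasCard-via toSolution fromSolution toSolution-cong fromSolution∘toSolution
                                  toSolution∘fromSolution (Solutions↔ _ k m)

corollary5p4 : (d : ℕ) → 1 ≤ d →
    Σ[ F ∈ (ℕ → ℕ → ℕ) ]
      ((k m : ℕ) → HasCard (Fiber d k m) _≈F_ (F k m)) ×
      ((K k m : ℕ) → k ≤ K →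
        ((λ a b → + F a b) *S prodTo d K) k m ≡ δ k m)
corollary5p4 (suc d) _ = weightCount (suc d) , fiberCard , weightCount-*S-prodTo (suc d)
  where
  fiberCard : (k m : ℕ) → HasCard (Fiber (suc d) k m) _≈F_ (weightCount (suc d) k m)
  fiberCard k m = subst (λ L → HasCard (Fiber (suc d) k m) _≈F_ (solutionCount L k m))
                        (map-ch-indicesBelow d k) (Fiber-hasCard (suc d) k m)
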